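{- The validity problem for $\mathsf{MSO}^\phi(\#)$ is decidable: there is an algorithm that decides, for any $\mathcal{L}^2_\#$ sentence, whether it is true in every finite model.
   Context: $\mathcal{L}^2_\#$ is monadic second-order logic with equality over finitely many unary predicates: individual variables, monadic second-order variables ranging over all subsets of the domain, Booleans, first- and second-order quantifiers, and count comparisons $\#_x\varphi\succsim\#_y\psi$ (arbitrarily nested), true iff $|\{d:\varphi\text{ holds with }x\mapsto d\}|\ge|\{d:\psi\text{ holds with }y\mapsto d\}|$. $\mathsf{MSO}^\phi(\#)$ is this logic over finite nonempty models. -}

module Defs where

open import Data.Nat using (ℕ; zero; suc; _≤ᵇ_)
open import Data.Bool using (Bool; true; false; not; _∧_; _∨_)
open import Data.Fin using (Fin)
open import Data.Fin.Subset using (Subset; inside; outside)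
open import Data.Vec using (Vec; []; _∷_; lookup)
open import Data.List using (List; []; _∷_; _++_; map; length; filterᵇ; allFin)
open import Data.Bool.ListAction using (any)
open import Relation.Binary.PropositionalEquality using (_≡_)

-- Formulas of L²_# over a signature of p unary predicates P₀ … P_{p-1},
-- with i free individual variables and j free monadic second-order
-- variables (de Bruijn indices).
data Formula (p : ℕ) : ℕ → ℕ → Set where
  pred  : ∀ {i j} → Fin p → Fin i → Formula p i j
  mem   : ∀ {i j} → Fin j → Fin i → Formula p i j
  eq    : ∀ {i j} → Fin i → Fin i → Formula p i j
  ⊤f    : ∀ {i j} → Formula p i j
  ¬f    : ∀ {i j} → Formula p i j → Formula p i j
  _∧f_  : ∀ {i j} → Formula p i j → Formula p i j → Formula p i j
  _∨f_  : ∀ {i j} → Formula p i j → Formula p i j → Formula p i j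
  ∃₁    : ∀ {i j} → Formula p (suc i) j → Formula p i j
  ∀₁    : ∀ {i j} → Formula p (suc i) j → Formula p i j
  ∃₂    : ∀ {i j} → Formula p i (suc j) → Formula p i j
  ∀₂    : ∀ {i j} → Formula p i (suc j) → Formula p i j
  -- #_x φ ≿ #_y ψ  (x, y are the newly bound variable, index 0)
  count : ∀ {i j} → Formula p (suc i) j → Formula p (suc i) j → Formula p i j

Sentence : ℕ → Set
Sentence p = Formula p 0 0

allSubsets : (m : ℕ) → List (Subset m)
allSubsets zero    = [] ∷ []
allSubsets (suc m) = map (inside ∷_) (allSubsets m) ++ map (outside ∷_) (allSubsets m)

_≟Fin_ : ∀ {m} → Fin m → Fin m → Bool
Fin.zero  ≟Fin Fin.zero  = true
Fin.zero  ≟Fin Fin.suc _ = false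
Fin.suc _ ≟Fin Fin.zero  = false
Fin.suc a ≟Fin Fin.suc b = a ≟Fin b

allB : ∀ {A : Set} → (A → Bool) → List A → Bool
allB f xs = not (any (λ x → not (f x)) xs)

⟦_⟧ : ∀ {p i j m} → Formula p i j → (Fin p → Subset m) →
      Vec (Fin m) i → Vec (Subset m) j → Bool
⟦ pred k x ⟧ I ρ σ = lookup (I k) (lookup ρ x)
⟦ mem X x ⟧ I ρ σ = lookup (lookup σ X) (lookup ρ x)
⟦ eq x y ⟧ I ρ σ = lookup ρ x ≟Fin lookup ρ y
⟦ ⊤f ⟧ I ρ σ = true
⟦ ¬f φ ⟧ I ρ σ = not (⟦ φ ⟧ I ρ σ)
⟦ φ ∧f ψ ⟧ I ρ σ = ⟦ φ ⟧ I ρ σ ∧ ⟦ ψ ⟧ I ρ σ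
⟦ φ ∨f ψ ⟧ I ρ σ = ⟦ φ ⟧ I ρ σ ∨ ⟦ ψ ⟧ I ρ σ
⟦_⟧ {m = m} (∃₁ φ) I ρ σ = any (λ d → ⟦ φ ⟧ I (d ∷ ρ) σ) (allFin m)
⟦_⟧ {m = m} (∀₁ φ) I ρ σ = allB (λ d → ⟦ φ ⟧ I (d ∷ ρ) σ) (allFin m)
⟦_⟧ {m = m} (∃₂ φ) I ρ σ = any (λ X → ⟦ φ ⟧ I ρ (X ∷ σ)) (allSubsets m)
⟦_⟧ {m = m} (∀₂ φ) I ρ σ = allB (λ X → ⟦ φ ⟧ I ρ (X ∷ σ)) (allSubsets m)
⟦_⟧ {m = m} (count φ ψ) I ρ σ =
  length (filterᵇ (λ d → ⟦ ψ ⟧ I (d ∷ ρ) σ) (allFin m))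
    ≤ᵇ length (filterᵇ (λ d → ⟦ φ ⟧ I (d ∷ ρ) σ) (allFin m))

-- Validity over finite nonempty models: true in every model with domain
-- Fin (suc n) (every finite nonempty model is isomorphic to one of these).
Valid : ∀ {p} → Sentence p → Set
Valid φ = ∀ (n : ℕ) (I : Fin _ → Subset (suc n)) → ⟦ φ ⟧ I [] [] ≡ true

{-# OPTIONS --safe #-}
-- A model over p unary predicates is determined up to isomorphism by the sizes of the 2^p
-- Venn regions of its predicates, and a further set (or an individual, as a singleton)
-- merely splits every region in two. So each formula translates into a Presburger formula
-- about region sizes: a set quantifier ranges over all ways of splitting every region, an
-- individual quantifier picks the region that receives the singleton, and a counting
-- comparison compares sums of region sizes. Validity becomes the truth of a Presburger
-- sentence, decided as in Büchi's theorem by compiling it into a finite automaton reading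
-- binary expansions: addition is a carry automaton, connectives are products and
-- complements, and ∃ is a subset construction.
module Submission where

open import Defs
open import Data.Bool.Base using (Bool; true; false; not; _∧_; _∨_; _xor_; T; if_then_else_)
open import Data.Bool.ListAction using (any; or)
open import Data.Bool.Properties using (T-∧; T-∨; T-≡; ∧-zeroʳ) renaming (_≟_ to _≟ᵇ_)
open import Data.Empty using (⊥; ⊥-elim)
open import Data.Fin.Base using (Fin; zero; suc; toℕ)
open import Data.Fin.Properties using (suc-injective; pigeonhole; toℕ<n; *↔×; +↔⊎; 2↔Bool; 1↔⊤)
open import Data.Fin.Subset using (Subset; ⁅_⁆) renaming (⊥ to ⊥ˢ)
open import Data.List.Base using (List; []; _∷_; _++_; length; take; drop; allFin; foldr; map; filterᵇ)
import Data.List.Base as List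
open import Data.List.Membership.Propositional using (_∈_; find; lose)
open import Data.List.Membership.Propositional.Properties using (∈-allFin; ∈-map⁺; ∈-++⁺ˡ; ∈-++⁺ʳ)
open import Data.List.Properties using (length-++; length-take; length-drop; take++drop≡id; map-cong)
open import Data.List.Relation.Unary.Any using (here)
open import Data.List.Relation.Unary.Any.Properties using (any⁺; any⁻)
open import Data.Maybe.Base using (Maybe; just; nothing; maybe′) renaming (map to mapᵐ)
open import Data.Nat.Base using (ℕ; zero; suc; _+_; _*_; _∸_; _^_; _≤_; _<_; _≤ᵇ_; _≡ᵇ_; z≤n; s≤s; s≤s⁻¹; ⌊_/2⌋)
open import Data.Nat.Induction using (<-wellFounded)
import Data.Nat.Properties as ℕ
open import Data.Nat.Properties
  using ( _≤?_; ≰⇒>; ≤-trans; <⇒≤; n≤1+n; m≤m+n; m≤n+m; m≤n⇒m⊓n≡m; +-monoˡ-<; m+[n∸m]≡n; ⌊n/2⌋<n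
        ; +-identityʳ; +-cancelˡ-≡; +-cancelʳ-≡; m+n≡0⇒n≡0; n≤0⇒n≡0; 1+n≢0; ≤ᵇ⇒≤; ≤⇒≤ᵇ)
open import Data.Nat.Tactic.RingSolver using (solve-∀)
open import Data.Product.Base using (∃; ∃-syntax; _×_; _,_; proj₂)
open import Data.Product.Function.NonDependent.Propositional using (_×-⇔_; _×-↔_)
open import Data.Sum.Base using (_⊎_; inj₁; inj₂; [_,_]′)
open import Data.Sum.Function.Propositional using (_⊎-⇔_; _⊎-↔_)
open import Data.Unit.Base using (⊤; tt)
open import Data.Vec.Base using (Vec; []; _∷_; lookup; tail; tabulate) renaming (map to mapⱽ)
open import Data.Vec.Properties using (lookup∘tabulate; tabulate-cong; lookup-map) renaming (≡-dec to ≡-decⱽ)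
open import Function.Base using (_∘_; id; const)
open import Function.Bundles using (_⇔_; mk⇔; Equivalence; _↔_; Inverse; mk↔ₛ′)
open import Function.Construct.Composition using (_↔-∘_)
open import Function.Construct.Symmetry using (↔-sym)
open import Function.Properties.Equivalence using () renaming (refl to ⇔-refl; trans to ⇔-trans; sym to ⇔-sym)
open import Function.Related.TypeIsomorphisms using (¬-cong-⇔)
open import Induction.WellFounded using (Acc; acc)
open import Relation.Binary.Definitions using (DecidableEquality)
open import Relation.Binary.PropositionalEquality
  using (_≡_; _≢_; refl; sym; trans; cong; cong₂; subst; subst₂; _≗_; module ≡-Reasoning)
open import Relation.Nullary.Decidable using (Dec; yes; no; does; T?; decidable-stable) renaming (map to Dec-map)
open import Relation.Nullary.Negation using (¬_)

open Equivalence using (to; from)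

private variable
  A V W : Set
  i j m n p q : ℕ

∃-⇔ : {I : Set} {A B : I → Set} → (∀ x → A x ⇔ B x) → ∃ A ⇔ ∃ B
∃-⇔ A⇔B = mk⇔ (λ (x , a) → x , to (A⇔B x) a) (λ (x , b) → x , from (A⇔B x) b)

∀-⇔ : {I : Set} {A B : I → Set} → (∀ x → A x ⇔ B x) → (∀ x → A x) ⇔ (∀ x → B x)
∀-⇔ A⇔B = mk⇔ (λ a x → to (A⇔B x) (a x)) (λ b x → from (A⇔B x) (b x))

≡-resp-⇔ : {x x′ y y′ : ℕ} → x ≡ x′ → y ≡ y′ → (x ≡ y) ⇔ (x′ ≡ y′)
≡-resp-⇔ refl refl = mk⇔ id id

T-≡-⇔ : {a b : Bool} → a ≡ b → T a ⇔ T b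
T-≡-⇔ refl = ⇔-refl

T-not : ∀ b → T (not b) ⇔ (¬ T b)
T-not false = mk⇔ (λ _ ()) _
T-not true  = mk⇔ (λ ()) (λ ¬⊤ → ¬⊤ _)

T-∨-bits : (f : Bool → Bool) → T (f false ∨ f true) ⇔ (∃[ b ] T (f b))
T-∨-bits f = mk⇔ (choose ∘ to T-∨) (from T-∨ ∘ inject)
  where
  choose : T (f false) ⊎ T (f true) → ∃[ b ] T (f b)
  choose (inj₁ h) = false , h
  choose (inj₂ h) = true  , h
  inject : ∃[ b ] T (f b) → T (f false) ⊎ T (f true)
  inject (false , h) = inj₁ h
  inject (true  , h) = inj₂ h

T-≟Fin : (i j : Fin n) → T (i ≟Fin j) ⇔ (i ≡ j)
T-≟Fin zero    zero    = mk⇔ (λ _ → refl) _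
T-≟Fin zero    (suc j) = mk⇔ (λ ()) (λ ())
T-≟Fin (suc i) zero    = mk⇔ (λ ()) (λ ())
T-≟Fin (suc i) (suc j) = ⇔-trans (T-≟Fin i j) (mk⇔ (cong suc) suc-injective)

∧-absorbs : ∀ a b → (T b → T a) → a ∧ b ≡ b
∧-absorbs true  b     _ = refl
∧-absorbs false false _ = refl
∧-absorbs false true  b⇒a = ⊥-elim (b⇒a _)

does-≟true : ∀ b → does (b ≟ᵇ true) ≡ b
does-≟true false = refl
does-≟true true  = refl

does-≟false : ∀ b → does (b ≟ᵇ false) ≡ not b
does-≟false false = refl
does-≟false true  = refl

T-any : (f : A → Bool) (xs : List A) → T (any f xs) ⇔ (∃[ x ] x ∈ xs × T (f x))
T-any f xs = mk⇔ (find ∘ any⁻ f xs) (λ (x , x∈xs , fx) → any⁺ f (lose x∈xs fx))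

T-any-allFin : (f : Fin n → Bool) → T (any f (allFin n)) ⇔ (∃[ i ] T (f i))
T-any-allFin f = ⇔-trans (T-any f _) (mk⇔ (λ (i , _ , fi) → i , fi) (λ (i , fi) → i , ∈-allFin i , fi))

any-cong : {f g : A → Bool} → f ≗ g → (xs : List A) → any f xs ≡ any g xs
any-cong f≗g xs = cong or (map-cong f≗g xs)

∈-allSubsets : ∀ m (X : Subset m) → X ∈ allSubsets m
∈-allSubsets zero    []          = here refl
∈-allSubsets (suc m) (true  ∷ X) = ∈-++⁺ˡ (∈-map⁺ (true ∷_) (∈-allSubsets m X))
∈-allSubsets (suc m) (false ∷ X) = ∈-++⁺ʳ (map (true ∷_) (allSubsets m)) (∈-map⁺ (false ∷_) (∈-allSubsets m X))

length-take++drop< : ∀ {i j} (xs : List A) → i < j → j ≤ length xs → length (take i xs ++ drop j xs) < length xs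
length-take++drop< {i = i} {j} xs i<j j≤len = begin-strict
  length (take i xs ++ drop j xs)  ≡⟨ length-++ (take i xs) ⟩
  length (take i xs) + length (drop j xs) ≡⟨ cong₂ _+_ (trans (length-take i xs) (m≤n⇒m⊓n≡m i≤len)) (length-drop j xs) ⟩
  i + (length xs ∸ j)              <⟨ +-monoˡ-< (length xs ∸ j) i<j ⟩
  j + (length xs ∸ j)              ≡⟨ m+[n∸m]≡n j≤len ⟩
  length xs                        ∎
  where
  open ℕ.≤-Reasoning
  i≤len = ≤-trans (<⇒≤ i<j) j≤len

uncons↔ : Vec A (suc n) ↔ (A × Vec A n)
uncons↔ = mk↔ₛ′ (λ { (x ∷ xs) → x , xs }) (λ (x , xs) → x ∷ xs) (λ _ → refl) (λ { (x ∷ xs) → refl })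

subset↔Fin : ∀ n → Subset n ↔ Fin (2 ^ n)
subset↔Fin zero    = ↔-sym 1↔⊤ ↔-∘ mk↔ₛ′ (const tt) (const []) (λ _ → refl) (λ { [] → refl })
subset↔Fin (suc n) = ↔-sym *↔× ↔-∘ ((↔-sym 2↔Bool ×-↔ subset↔Fin n) ↔-∘ uncons↔)

-- Binary numerals

bitValue : Bool → ℕ
bitValue false = 0
bitValue true  = 1

lsb : ℕ → Bool
lsb zero          = false
lsb (suc zero)    = true
lsb (suc (suc n)) = lsb n

infixr 5 _∷ᵇ_
_∷ᵇ_ : Bool → ℕ → ℕ
b ∷ᵇ n = bitValue b + (n + n)

∷ᵇ-suc : ∀ b n → b ∷ᵇ suc n ≡ suc (suc (b ∷ᵇ n))
∷ᵇ-suc b n = lemma (bitValue b) n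
  where
  lemma : ∀ x n → x + (suc n + suc n) ≡ suc (suc (x + (n + n)))
  lemma = solve-∀

lsb-∷ᵇ : ∀ b n → lsb (b ∷ᵇ n) ≡ b
lsb-∷ᵇ false zero    = refl
lsb-∷ᵇ true  zero    = refl
lsb-∷ᵇ b     (suc n) = trans (cong lsb (∷ᵇ-suc b n)) (lsb-∷ᵇ b n)

⌊∷ᵇ/2⌋ : ∀ b n → ⌊ b ∷ᵇ n /2⌋ ≡ n
⌊∷ᵇ/2⌋ false zero    = refl
⌊∷ᵇ/2⌋ true  zero    = refl
⌊∷ᵇ/2⌋ b     (suc n) = trans (cong ⌊_/2⌋ (∷ᵇ-suc b n)) (cong suc (⌊∷ᵇ/2⌋ b n))

lsb∷ᵇ⌊/2⌋ : ∀ n → lsb n ∷ᵇ ⌊ n /2⌋ ≡ n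
lsb∷ᵇ⌊/2⌋ zero          = refl
lsb∷ᵇ⌊/2⌋ (suc zero)    = refl
lsb∷ᵇ⌊/2⌋ (suc (suc n)) = trans (∷ᵇ-suc (lsb n) ⌊ n /2⌋) (cong (λ k → suc (suc k)) (lsb∷ᵇ⌊/2⌋ n))

∷ᵇ≡∷ᵇ : ∀ {a b m n} → (a ∷ᵇ m ≡ b ∷ᵇ n) ⇔ (a ≡ b × m ≡ n)
∷ᵇ≡∷ᵇ {a} {b} {m} {n} = mk⇔
  (λ same → trans (sym (lsb-∷ᵇ a m)) (trans (cong lsb same) (lsb-∷ᵇ b n)) ,
            trans (sym (⌊∷ᵇ/2⌋ a m)) (trans (cong ⌊_/2⌋ same) (⌊∷ᵇ/2⌋ b n)))
  (λ { (refl , refl) → refl })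

carry : Bool → Bool → Bool → Bool
carry a b c = (a ∧ b) ∨ (c ∧ (a xor b))

fullAdder : ∀ a b c → bitValue a + bitValue b + bitValue c ≡ (a xor b xor c) ∷ᵇ bitValue (carry a b c)
fullAdder false false false = refl
fullAdder false false true  = refl
fullAdder false true  false = refl
fullAdder false true  true  = refl
fullAdder true  false false = refl
fullAdder true  false true  = refl
fullAdder true  true  false = refl
fullAdder true  true  true  = refl

∷ᵇ-+ : ∀ a b c m n →
       (a ∷ᵇ m) + (b ∷ᵇ n) + bitValue c ≡ (a xor b xor c) ∷ᵇ (m + n + bitValue (carry a b c))
∷ᵇ-+ a b c m n = begin
  (a ∷ᵇ m) + (b ∷ᵇ n) + bitValue c                        ≡⟨ regroup (bitValue a) (bitValue b) (bitValue c) m n ⟩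
  bitValue a + bitValue b + bitValue c + ((m + n) + (m + n)) ≡⟨ cong (_+ ((m + n) + (m + n))) (fullAdder a b c) ⟩
  ((a xor b xor c) ∷ᵇ k) + ((m + n) + (m + n))            ≡⟨ regroup′ (bitValue (a xor b xor c)) k m n ⟩
  (a xor b xor c) ∷ᵇ (m + n + k)                          ∎
  where
  open ≡-Reasoning
  k = bitValue (carry a b c)
  regroup : ∀ x y z m n → x + (m + m) + (y + (n + n)) + z ≡ x + y + z + ((m + n) + (m + n))
  regroup = solve-∀
  regroup′ : ∀ s k m n → s + (k + k) + ((m + n) + (m + n)) ≡ s + ((m + n + k) + (m + n + k))
  regroup′ = solve-∀

⌊_/2^_⌋ : ℕ → ℕ → ℕ
⌊ n /2^ zero  ⌋ = n
⌊ n /2^ suc L ⌋ = ⌊ ⌊ n /2⌋ /2^ L ⌋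

⌊n/2^[a+b]⌋ : ∀ n a b → ⌊ n /2^ (a + b) ⌋ ≡ ⌊ ⌊ n /2^ a ⌋ /2^ b ⌋
⌊n/2^[a+b]⌋ n zero    b = refl
⌊n/2^[a+b]⌋ n (suc a) b = ⌊n/2^[a+b]⌋ ⌊ n /2⌋ a b

⌊0/2^L⌋≡0 : ∀ L → ⌊ 0 /2^ L ⌋ ≡ 0
⌊0/2^L⌋≡0 zero    = refl
⌊0/2^L⌋≡0 (suc L) = ⌊0/2^L⌋≡0 L

⌊n/2^L⌋≡0 : ∀ {n} L → n ≤ L → ⌊ n /2^ L ⌋ ≡ 0
⌊n/2^L⌋≡0 {zero}  L       _         = ⌊0/2^L⌋≡0 L
⌊n/2^L⌋≡0 {suc n} (suc L) (s≤s n≤L) = ⌊n/2^L⌋≡0 L (≤-trans (s≤s⁻¹ (⌊n/2⌋<n n)) n≤L)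

fromBits : List Bool → ℕ
fromBits = foldr _∷ᵇ_ 0

toBits : ℕ → ℕ → List Bool
toBits zero    y = []
toBits (suc K) y = lsb y ∷ toBits K ⌊ y /2⌋

toBits-fromBits : ∀ w → toBits (length w) (fromBits w) ≡ w
toBits-fromBits []      = refl
toBits-fromBits (b ∷ w) =
  cong₂ _∷_ (lsb-∷ᵇ b (fromBits w)) (trans (cong (toBits (length w)) (⌊∷ᵇ/2⌋ b (fromBits w))) (toBits-fromBits w))

⌊fromBits/2^length⌋≡0 : ∀ w → ⌊ fromBits w /2^ length w ⌋ ≡ 0
⌊fromBits/2^length⌋≡0 []      = refl
⌊fromBits/2^length⌋≡0 (b ∷ w) =
  trans (cong ⌊_/2^ length w ⌋ (⌊∷ᵇ/2⌋ b (fromBits w))) (⌊fromBits/2^length⌋≡0 w)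

-- Presburger arithmetic

infixr 5 _∷ᵉ_
_∷ᵉ_ : {A : Set} → A → (V → A) → Maybe V → A
x ∷ᵉ e = maybe′ e x

∷ᵉ-cong : {A : Set} (x : A) {e e′ : V → A} → e ≗ e′ → x ∷ᵉ e ≗ x ∷ᵉ e′
∷ᵉ-cong x e≗e′ nothing  = refl
∷ᵉ-cong x e≗e′ (just v) = e≗e′ v

infix  6 _⊕_≐_
infixr 4 _∧ₚ_
infixr 3 _∨ₚ_

-- Addition is the only atomic formula: 0, 1, equality and order are definable.
data PA (V : Set) : Set where
  _⊕_≐_ : V → V → V → PA V
  ¬ₚ_   : PA V → PA V
  _∧ₚ_  : PA V → PA V → PA V
  _∨ₚ_  : PA V → PA V → PA V
  ∃ₚ_   : PA (Maybe V) → PA V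

Env : Set → Set
Env V = V → ℕ

⟦_⟧ₚ : PA V → Env V → Set
⟦ u ⊕ v ≐ w ⟧ₚ e = e u + e v ≡ e w
⟦ ¬ₚ φ ⟧ₚ     e = ¬ ⟦ φ ⟧ₚ e
⟦ φ ∧ₚ ψ ⟧ₚ   e = ⟦ φ ⟧ₚ e × ⟦ ψ ⟧ₚ e
⟦ φ ∨ₚ ψ ⟧ₚ   e = ⟦ φ ⟧ₚ e ⊎ ⟦ ψ ⟧ₚ e
⟦ ∃ₚ φ ⟧ₚ     e = ∃[ x ] ⟦ φ ⟧ₚ (x ∷ᵉ e)

rename : (V → W) → PA V → PA W
rename f (u ⊕ v ≐ w) = f u ⊕ f v ≐ f w
rename f (¬ₚ φ)      = ¬ₚ rename f φ
rename f (φ ∧ₚ ψ)    = rename f φ ∧ₚ rename f ψ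
rename f (φ ∨ₚ ψ)    = rename f φ ∨ₚ rename f ψ
rename f (∃ₚ φ)      = ∃ₚ rename (mapᵐ f) φ

⟦⟧ₚ-cong : (φ : PA V) {e e′ : Env V} → e ≗ e′ → ⟦ φ ⟧ₚ e ⇔ ⟦ φ ⟧ₚ e′
⟦⟧ₚ-cong (u ⊕ v ≐ w) e≗e′ = ≡-resp-⇔ (cong₂ _+_ (e≗e′ u) (e≗e′ v)) (e≗e′ w)
⟦⟧ₚ-cong (¬ₚ φ)      e≗e′ = ¬-cong-⇔ (⟦⟧ₚ-cong φ e≗e′)
⟦⟧ₚ-cong (φ ∧ₚ ψ)    e≗e′ = ⟦⟧ₚ-cong φ e≗e′ ×-⇔ ⟦⟧ₚ-cong ψ e≗e′
⟦⟧ₚ-cong (φ ∨ₚ ψ)    e≗e′ = ⟦⟧ₚ-cong φ e≗e′ ⊎-⇔ ⟦⟧ₚ-cong ψ e≗e′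
⟦⟧ₚ-cong (∃ₚ φ)      e≗e′ = ∃-⇔ (λ x → ⟦⟧ₚ-cong φ (∷ᵉ-cong x e≗e′))

⟦rename⟧ₚ : (f : V → W) (φ : PA V) (e : Env W) → ⟦ rename f φ ⟧ₚ e ⇔ ⟦ φ ⟧ₚ (e ∘ f)
⟦rename⟧ₚ f (u ⊕ v ≐ w) e = mk⇔ id id
⟦rename⟧ₚ f (¬ₚ φ)      e = ¬-cong-⇔ (⟦rename⟧ₚ f φ e)
⟦rename⟧ₚ f (φ ∧ₚ ψ)    e = ⟦rename⟧ₚ f φ e ×-⇔ ⟦rename⟧ₚ f ψ e
⟦rename⟧ₚ f (φ ∨ₚ ψ)    e = ⟦rename⟧ₚ f φ e ⊎-⇔ ⟦rename⟧ₚ f ψ e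
⟦rename⟧ₚ f (∃ₚ φ)      e =
  ∃-⇔ λ x → ⇔-trans (⟦rename⟧ₚ (mapᵐ f) φ (x ∷ᵉ e)) (⟦⟧ₚ-cong φ (∷ᵉ-∘-map x))
  where
  ∷ᵉ-∘-map : ∀ x → (x ∷ᵉ e) ∘ mapᵐ f ≗ x ∷ᵉ (e ∘ f)
  ∷ᵉ-∘-map x nothing  = refl
  ∷ᵉ-∘-map x (just v) = refl

-- Automata

record DFA (V : Set) : Set₁ where
  field
    State     : Set
    size      : ℕ
    enumerate : State ↔ Fin size
    step      : State → (V → Bool) → State
    -- letters are functions, and without extensionality step has to respect pointwise equality
    step-cong : ∀ q {ℓ ℓ′} → ℓ ≗ ℓ′ → step q ℓ ≡ step q ℓ′
    accepting : State → Bool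
    start     : State

open DFA public

run : (A : DFA V) → State A → ℕ → Env V → State A
run A q zero    e = q
run A q (suc L) e = run A (step A q (lsb ∘ e)) L (⌊_/2⌋ ∘ e)

run-cong : (A : DFA V) (q : State A) (L : ℕ) {e e′ : Env V} → e ≗ e′ → run A q L e ≡ run A q L e′
run-cong A q zero    e≗e′ = refl
run-cong A q (suc L) e≗e′ =
  trans (cong (λ p → run A p L _) (step-cong A q (cong lsb ∘ e≗e′))) (run-cong A _ L (cong ⌊_/2⌋ ∘ e≗e′))

run-+ : (A : DFA V) (q : State A) (a b : ℕ) (e : Env V) →
        run A q (a + b) e ≡ run A (run A q a e) b (λ v → ⌊ e v /2^ a ⌋)
run-+ A q zero    b e = refl
run-+ A q (suc a) b e = run-+ A _ a b _

Fits : ℕ → Env V → Set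
Fits L e = ∀ v → ⌊ e v /2^ L ⌋ ≡ 0

Recognises : DFA V → PA V → Set
Recognises A φ = ∀ L e → Fits L e → ⟦ φ ⟧ₚ e ⇔ T (accepting A (run A (start A) L e))

recognises-invariant :
  (A : DFA V) (M : State A → Env V → Set) →
  (∀ q e → M q e ⇔ M (step A q (lsb ∘ e)) (⌊_/2⌋ ∘ e)) →
  (∀ q e → (∀ v → e v ≡ 0) → M q e ⇔ T (accepting A q)) →
  ∀ L q e → Fits L e → M q e ⇔ T (accepting A (run A q L e))
recognises-invariant A M preserved final zero    q e fits = final q e fits
recognises-invariant A M preserved final (suc L) q e fits =
  ⇔-trans (preserved q e) (recognises-invariant A M preserved final L _ _ fits)

fits-+ : ∀ L K {e : Env V} → Fits L e → Fits (L + K) e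
fits-+ L K {e} fits v = trans (⌊n/2^[a+b]⌋ (e v) L K) (trans (cong ⌊_/2^ K ⌋ (fits v)) (⌊0/2^L⌋≡0 K))

run-suc-∷ᵉ : (A : DFA (Maybe V)) (p : State A) (L x : ℕ) (e : Env V) →
             run A p (suc L) (x ∷ᵉ e) ≡ run A (step A p (lsb x ∷ᵉ lsb ∘ e)) L (⌊ x /2⌋ ∷ᵉ ⌊_/2⌋ ∘ e)
run-suc-∷ᵉ A p L x e =
  trans (cong (λ q → run A q L _) (step-cong A p pointwise)) (run-cong A _ L pointwise)
  where
  pointwise : {B : Set} {f : ℕ → B} → f ∘ (x ∷ᵉ e) ≗ f x ∷ᵉ f ∘ e
  pointwise nothing  = refl
  pointwise (just v) = refl

run-suc-∷ᵇ : (A : DFA (Maybe V)) (p : State A) (L : ℕ) (b : Bool) (x : ℕ) (e : Env V) →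
             run A p (suc L) ((b ∷ᵇ x) ∷ᵉ e) ≡ run A (step A p (b ∷ᵉ lsb ∘ e)) L (x ∷ᵉ ⌊_/2⌋ ∘ e)
run-suc-∷ᵇ A p L b x e = trans (run-suc-∷ᵉ A p L (b ∷ᵇ x) e)
  (cong₂ (λ c y → run A (step A p (c ∷ᵉ lsb ∘ e)) L (y ∷ᵉ ⌊_/2⌋ ∘ e)) (lsb-∷ᵇ b x) (⌊∷ᵇ/2⌋ b x))

-- The adder's state is the current carry, or failure once a bit of w contradicts u + v.
pattern carrying c = inj₁ c
pattern failed     = inj₂ tt

module _ (u v w : V) where

  addStep : Bool ⊎ ⊤ → (V → Bool) → Bool ⊎ ⊤
  addStep failed       ℓ = failed
  addStep (carrying c) ℓ =
    if (ℓ u xor ℓ v xor c) xor ℓ w then failed else carrying (carry (ℓ u) (ℓ v) c)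

  addStep-cong : ∀ q {ℓ ℓ′} → ℓ ≗ ℓ′ → addStep q ℓ ≡ addStep q ℓ′
  addStep-cong failed       ℓ≗ℓ′ = refl
  addStep-cong (carrying c) ℓ≗ℓ′ rewrite ℓ≗ℓ′ u | ℓ≗ℓ′ v | ℓ≗ℓ′ w = refl

  addAccepting : Bool ⊎ ⊤ → Bool
  addAccepting failed       = false
  addAccepting (carrying c) = not c

  adder : DFA V
  adder = record
    { State     = Bool ⊎ ⊤
    ; size      = 3
    ; enumerate = ↔-sym (+↔⊎ {2} {1}) ↔-∘ (↔-sym 2↔Bool ⊎-↔ ↔-sym 1↔⊤)
    ; step      = addStep
    ; step-cong = addStep-cong
    ; accepting = addAccepting
    ; start     = carrying false
    }

  SumHolds : Bool ⊎ ⊤ → Env V → Set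
  SumHolds failed       e = ⊥
  SumHolds (carrying c) e = e u + e v + bitValue c ≡ e w

  sumHolds-step : ∀ q e → SumHolds q e ⇔ SumHolds (addStep q (lsb ∘ e)) (⌊_/2⌋ ∘ e)
  sumHolds-step failed       e = mk⇔ id id
  sumHolds-step (carrying c) e =
    ⇔-trans (≡-resp-⇔ split (sym (lsb∷ᵇ⌊/2⌋ (e w))))
            (⇔-trans ∷ᵇ≡∷ᵇ (agree (lsb (e u) xor lsb (e v) xor c) (lsb (e w))))
    where
    a = lsb (e u)
    b = lsb (e v)
    split : e u + e v + bitValue c ≡ (a xor b xor c) ∷ᵇ (⌊ e u /2⌋ + ⌊ e v /2⌋ + bitValue (carry a b c))
    split = trans (cong₂ (λ x y → x + y + bitValue c) (sym (lsb∷ᵇ⌊/2⌋ (e u))) (sym (lsb∷ᵇ⌊/2⌋ (e v))))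
                  (∷ᵇ-+ a b c ⌊ e u /2⌋ ⌊ e v /2⌋)
    agree : ∀ s d → (s ≡ d × ⌊ e u /2⌋ + ⌊ e v /2⌋ + bitValue (carry a b c) ≡ ⌊ e w /2⌋)
                    ⇔ SumHolds (if s xor d then failed else carrying (carry a b c)) (⌊_/2⌋ ∘ e)
    agree false false = mk⇔ proj₂ (refl ,_)
    agree true  true  = mk⇔ proj₂ (refl ,_)
    agree false true  = mk⇔ (λ ()) λ ()
    agree true  false = mk⇔ (λ ()) λ ()

  sumHolds-final : ∀ q e → (∀ x → e x ≡ 0) → SumHolds q e ⇔ T (addAccepting q)
  sumHolds-final failed       e zeros = mk⇔ id id
  sumHolds-final (carrying c) e zeros rewrite zeros u | zeros v | zeros w = bit≡0 c
    where
    bit≡0 : ∀ c → (bitValue c ≡ 0) ⇔ T (not c)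
    bit≡0 false = mk⇔ _ (λ _ → refl)
    bit≡0 true  = mk⇔ (λ ()) λ ()

  adder-recognises : Recognises adder (u ⊕ v ≐ w)
  adder-recognises L e fits =
    ⇔-trans (≡-resp-⇔ (sym (+-identityʳ _)) refl)
            (recognises-invariant adder SumHolds sumHolds-step sumHolds-final L (carrying false) e fits)

complement : DFA V → DFA V
complement A = record A { accepting = not ∘ accepting A }

run-complement : (A : DFA V) (q : State A) (L : ℕ) (e : Env V) → run (complement A) q L e ≡ run A q L e
run-complement A q zero    e = refl
run-complement A q (suc L) e = run-complement A _ L _

complement-recognises : (A : DFA V) (φ : PA V) → Recognises A φ → Recognises (complement A) (¬ₚ φ)
complement-recognises A φ A-φ L e fits rewrite run-complement A (start A) L e =
  ⇔-trans (¬-cong-⇔ (A-φ L e fits)) (⇔-sym (T-not _))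

product : (Bool → Bool → Bool) → DFA V → DFA V → DFA V
product _⊙_ A B = record
  { State     = State A × State B
  ; size      = size A * size B
  ; enumerate = ↔-sym *↔× ↔-∘ (enumerate A ×-↔ enumerate B)
  ; step      = λ (p , q) ℓ → step A p ℓ , step B q ℓ
  ; step-cong = λ (p , q) ℓ≗ℓ′ → cong₂ _,_ (step-cong A p ℓ≗ℓ′) (step-cong B q ℓ≗ℓ′)
  ; accepting = λ (p , q) → accepting A p ⊙ accepting B q
  ; start     = start A , start B
  }

run-product : ∀ _⊙_ (A B : DFA V) p q L e →
              run (product _⊙_ A B) (p , q) L e ≡ (run A p L e , run B q L e)
run-product _⊙_ A B p q zero    e = refl
run-product _⊙_ A B p q (suc L) e = run-product _⊙_ A B _ _ L _

intersection-recognises : (A B : DFA V) (φ ψ : PA V) → Recognises A φ → Recognises B ψ →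
                          Recognises (product _∧_ A B) (φ ∧ₚ ψ)
intersection-recognises A B φ ψ A-φ B-ψ L e fits rewrite run-product _∧_ A B (start A) (start B) L e =
  ⇔-trans (A-φ L e fits ×-⇔ B-ψ L e fits) (⇔-sym T-∧)

union-recognises : (A B : DFA V) (φ ψ : PA V) → Recognises A φ → Recognises B ψ →
                   Recognises (product _∨_ A B) (φ ∨ₚ ψ)
union-recognises A B φ ψ A-φ B-ψ L e fits rewrite run-product _∨_ A B (start A) (start B) L e =
  ⇔-trans (A-φ L e fits ⊎-⇔ B-ψ L e fits) (⇔-sym T-∨)

-- Subset construction guessing the bits of the projected variable. When the other variables
-- have been read completely, the projected one may still have high bits: a set of states is
-- accepting when one of them reaches acceptance by reading further bits of it alone, and by
-- pigeonhole `size A` such padding bits suffice.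
module Projection {V : Set} (A : DFA (Maybe V)) where

  index : State A → Fin (size A)
  index = Inverse.to (enumerate A)

  state : Fin (size A) → State A
  state = Inverse.from (enumerate A)

  state-index : ∀ q → state (index q) ≡ q
  state-index = Inverse.strictlyInverseʳ (enumerate A)

  index-injective : ∀ {p q} → index p ≡ index q → p ≡ q
  index-injective {p} {q} same = trans (sym (state-index p)) (trans (cong state same) (state-index q))

  anyState : (State A → Bool) → Bool
  anyState f = any (f ∘ state) (allFin (size A))

  T-anyState : (f : State A → Bool) → T (anyState f) ⇔ (∃[ q ] T (f q))
  T-anyState f = ⇔-trans (T-any-allFin (f ∘ state)) (mk⇔ (λ (i , h) → state i , h)
    (λ (q , h) → index q , subst (T ∘ f) (sym (state-index q)) h))

  padding : Bool → Maybe V → Bool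
  padding b = b ∷ᵉ const false

  runPadding : State A → List Bool → State A
  runPadding q []      = q
  runPadding q (b ∷ w) = runPadding (step A q (padding b)) w

  runPadding-++ : ∀ q u w → runPadding q (u ++ w) ≡ runPadding (runPadding q u) w
  runPadding-++ q []      w = refl
  runPadding-++ q (b ∷ u) w = runPadding-++ _ u w

  run-padding : ∀ K q y → run A q K (y ∷ᵉ const 0) ≡ runPadding q (toBits K y)
  run-padding zero    q y = refl
  run-padding (suc K) q y = trans (run-suc-∷ᵉ A q K y (const 0)) (run-padding K _ ⌊ y /2⌋)

  shorten-once : ∀ q w → size A < length w →
                 ∃[ w′ ] length w′ < length w × runPadding q w′ ≡ runPadding q w
  shorten-once q w size<len =
    let i , j , i<j , same = pigeonhole (≤-trans size<len (n≤1+n _)) (λ k → index (runPadding q (take (toℕ k) w)))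
        j≤len = s≤s⁻¹ (toℕ<n j)
    in take (toℕ i) w ++ drop (toℕ j) w , length-take++drop< w i<j j≤len , (begin
         runPadding q (take (toℕ i) w ++ drop (toℕ j) w)             ≡⟨ runPadding-++ q (take (toℕ i) w) _ ⟩
         runPadding (runPadding q (take (toℕ i) w)) (drop (toℕ j) w)
           ≡⟨ cong (λ p → runPadding p (drop (toℕ j) w)) (index-injective same) ⟩
         runPadding (runPadding q (take (toℕ j) w)) (drop (toℕ j) w) ≡⟨ runPadding-++ q (take (toℕ j) w) _ ⟨
         runPadding q (take (toℕ j) w ++ drop (toℕ j) w)             ≡⟨ cong (runPadding q) (take++drop≡id (toℕ j) w) ⟩
         runPadding q w                                              ∎)
    where open ≡-Reasoning

  shorten : ∀ q w → Acc _<_ (length w) → ∃[ w′ ] length w′ ≤ size A × runPadding q w′ ≡ runPadding q w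
  shorten q w (acc smaller) with length w ≤? size A
  ... | yes len≤size = w , len≤size , refl
  ... | no  len≰size =
    let w′ , shorter , same  = shorten-once q w (≰⇒> len≰size)
        w″ , bounded , same′ = shorten q w′ (smaller shorter)
    in w″ , bounded , trans same′ same

  acceptsPadding : ℕ → State A → Bool
  acceptsPadding zero    q = accepting A q
  acceptsPadding (suc n) q =
    accepting A q ∨ (acceptsPadding n (step A q (padding false)) ∨ acceptsPadding n (step A q (padding true)))

  T-acceptsPadding : ∀ n q → T (acceptsPadding n q) ⇔ (∃[ w ] length w ≤ n × T (accepting A (runPadding q w)))
  T-acceptsPadding zero    q = mk⇔ (λ h → [] , z≤n , h) λ { ([] , _ , h) → h }
  T-acceptsPadding (suc n) q = mk⇔ sound complete
    where
    sound : T (acceptsPadding (suc n) q) → ∃[ w ] length w ≤ suc n × T (accepting A (runPadding q w))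
    sound h with to T-∨ h
    ... | inj₁ now = [] , z≤n , now
    ... | inj₂ later with to (T-∨-bits (λ b → acceptsPadding n (step A q (padding b)))) later
    ...   | b , hb with to (T-acceptsPadding n _) hb
    ...     | w , len≤n , accepted = b ∷ w , s≤s len≤n , accepted
    complete : ∃[ w ] length w ≤ suc n × T (accepting A (runPadding q w)) → T (acceptsPadding (suc n) q)
    complete ([]    , _         , h) = from T-∨ (inj₁ h)
    complete (b ∷ w , s≤s len≤n , h) =
      from (T-∨ {accepting A q}) (inj₂ (from (T-∨-bits (λ b → acceptsPadding n (step A q (padding b))))
                           (b , from (T-acceptsPadding n _) (w , len≤n , h))))

  acceptsPadding-size : ∀ q → T (acceptsPadding (size A) q) ⇔ (∃[ w ] T (accepting A (runPadding q w)))
  acceptsPadding-size q = ⇔-trans (T-acceptsPadding (size A) q) (mk⇔ (λ (w , _ , h) → w , h) shortened)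
    where
    shortened : ∃[ w ] T (accepting A (runPadding q w)) → ∃[ w ] length w ≤ size A × T (accepting A (runPadding q w))
    shortened (w , h) = let w′ , bounded , same = shorten q w (<-wellFounded _)
                        in w′ , bounded , subst (T ∘ accepting A) (sym same) h

  StateSet : Set
  StateSet = Subset (size A)

  _∈ₛ_ : State A → StateSet → Set
  q ∈ₛ S = T (lookup S (index q))

  stepSet : StateSet → (V → Bool) → StateSet
  stepSet S ℓ = tabulate λ i → anyState λ p →
    lookup S (index p) ∧ (index (step A p (false ∷ᵉ ℓ)) ≟Fin i ∨ index (step A p (true ∷ᵉ ℓ)) ≟Fin i)

  stepSet-cong : ∀ S {ℓ ℓ′} → ℓ ≗ ℓ′ → stepSet S ℓ ≡ stepSet S ℓ′
  stepSet-cong S ℓ≗ℓ′ = tabulate-cong λ i → any-cong (λ j → cong (lookup S (index (state j)) ∧_)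
    (cong₂ (λ p q → index p ≟Fin i ∨ index q ≟Fin i)
           (step-cong A (state j) (∷ᵉ-cong false ℓ≗ℓ′)) (step-cong A (state j) (∷ᵉ-cong true ℓ≗ℓ′))))
    (allFin (size A))

  ∈-stepSet : ∀ S ℓ q → q ∈ₛ stepSet S ℓ ⇔ (∃[ p ] p ∈ₛ S × ∃[ b ] step A p (b ∷ᵉ ℓ) ≡ q)
  ∈-stepSet S ℓ q =
    ⇔-trans (T-≡-⇔ (lookup∘tabulate _ (index q)))
            (⇔-trans (T-anyState _) (∃-⇔ λ p → ⇔-trans T-∧ (⇔-refl ×-⇔ successor p)))
    where
    successor : ∀ p → T (index (step A p (false ∷ᵉ ℓ)) ≟Fin index q ∨ index (step A p (true ∷ᵉ ℓ)) ≟Fin index q)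
                      ⇔ (∃[ b ] step A p (b ∷ᵉ ℓ) ≡ q)
    successor p = ⇔-trans (T-∨-bits _) (∃-⇔ λ b → ⇔-trans (T-≟Fin _ _) (mk⇔ index-injective (cong index)))

  startSet : StateSet
  startSet = tabulate (_≟Fin index (start A))

  ∈-startSet : ∀ q → q ∈ₛ startSet ⇔ (q ≡ start A)
  ∈-startSet q = ⇔-trans (T-≡-⇔ (lookup∘tabulate _ (index q)))
                         (⇔-trans (T-≟Fin _ _) (mk⇔ index-injective (cong index)))

  acceptingSet : StateSet → Bool
  acceptingSet S = anyState λ q → lookup S (index q) ∧ acceptsPadding (size A) q

  T-acceptingSet : ∀ S → T (acceptingSet S) ⇔ (∃[ q ] q ∈ₛ S × ∃[ w ] T (accepting A (runPadding q w)))
  T-acceptingSet S = ⇔-trans (T-anyState _) (∃-⇔ λ q → ⇔-trans T-∧ (⇔-refl ×-⇔ acceptsPadding-size q))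

  projection : DFA V
  projection = record
    { State     = StateSet
    ; size      = 2 ^ size A
    ; enumerate = subset↔Fin (size A)
    ; step      = stepSet
    ; step-cong = stepSet-cong
    ; accepting = acceptingSet
    ; start     = startSet
    }

  run-projection-complete : ∀ L S e p x → p ∈ₛ S → run A p L (x ∷ᵉ e) ∈ₛ run projection S L e
  run-projection-complete zero    S e p x p∈S = p∈S
  run-projection-complete (suc L) S e p x p∈S =
    subst (_∈ₛ run projection (stepSet S (lsb ∘ e)) L (⌊_/2⌋ ∘ e)) (sym (run-suc-∷ᵉ A p L x e))
      (run-projection-complete L _ _ _ ⌊ x /2⌋ (from (∈-stepSet S (lsb ∘ e) _) (p , p∈S , lsb x , refl)))

  -- The high part y of the witness is left free, so that padding can be appended to it.
  run-projection-sound : ∀ L S e q → q ∈ₛ run projection S L e →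
                         ∃[ p ] p ∈ₛ S × ∀ y → ∃[ x ] ⌊ x /2^ L ⌋ ≡ y × run A p L (x ∷ᵉ e) ≡ q
  run-projection-sound zero    S e q q∈S = q , q∈S , λ y → y , refl , refl
  run-projection-sound (suc L) S e q q∈R
    with p′ , p′∈S′ , extend ← run-projection-sound L (stepSet S (lsb ∘ e)) (⌊_/2⌋ ∘ e) q q∈R
    with p , p∈S , b , p→p′ ← to (∈-stepSet S (lsb ∘ e) p′) p′∈S′
    = p , p∈S , λ y → let x′ , high , reaches = extend y in
        b ∷ᵇ x′ , trans (cong ⌊_/2^ L ⌋ (⌊∷ᵇ/2⌋ b x′)) high ,
        trans (run-suc-∷ᵇ A p L b x′ e) (trans (cong (λ r → run A r L _) p→p′) reaches)

  run-then-padding : ∀ L K p x e → Fits L e →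
                     run A p (L + K) (x ∷ᵉ e) ≡ runPadding (run A p L (x ∷ᵉ e)) (toBits K ⌊ x /2^ L ⌋)
  run-then-padding L K p x e fits = begin
    run A p (L + K) (x ∷ᵉ e)                                ≡⟨ run-+ A p L K (x ∷ᵉ e) ⟩
    run A (run A p L (x ∷ᵉ e)) K (λ v → ⌊ (x ∷ᵉ e) v /2^ L ⌋) ≡⟨ run-cong A _ K high ⟩
    run A (run A p L (x ∷ᵉ e)) K (⌊ x /2^ L ⌋ ∷ᵉ const 0)    ≡⟨ run-padding K _ _ ⟩
    runPadding (run A p L (x ∷ᵉ e)) (toBits K ⌊ x /2^ L ⌋)  ∎
    where
    open ≡-Reasoning
    high : (λ v → ⌊ (x ∷ᵉ e) v /2^ L ⌋) ≗ ⌊ x /2^ L ⌋ ∷ᵉ const 0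
    high nothing  = refl
    high (just v) = fits v

  projection-recognises : (φ : PA (Maybe V)) → Recognises A φ → Recognises projection (∃ₚ φ)
  projection-recognises φ A-φ L e fits = mk⇔ accepted witnessed
    where
    accepted : ⟦ ∃ₚ φ ⟧ₚ e → T (acceptingSet (run projection startSet L e))
    accepted (x , φx) = from (T-acceptingSet (run projection startSet L e))
      (run A (start A) L (x ∷ᵉ e) , run-projection-complete L startSet e (start A) x (from (∈-startSet _) refl) ,
       toBits x ⌊ x /2^ L ⌋ ,
       subst (T ∘ accepting A) (run-then-padding L x (start A) x e fits) (to (A-φ (L + x) (x ∷ᵉ e) fits′) φx))
      where
      fits′ : Fits (L + x) (x ∷ᵉ e)
      fits′ nothing  = ⌊n/2^L⌋≡0 (L + x) (m≤n+m x L)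
      fits′ (just v) = fits-+ L x fits v

    witnessed : T (acceptingSet (run projection startSet L e)) → ⟦ ∃ₚ φ ⟧ₚ e
    witnessed h
      with q , q∈R , w , accepts ← to (T-acceptingSet (run projection startSet L e)) h
      with p , p∈start , extend ← run-projection-sound L startSet e q q∈R
      with x , high , reaches ← extend (fromBits w)
      = x , from (A-φ (L + length w) (x ∷ᵉ e) fits′) (subst (T ∘ accepting A) (sym runs-to) accepts)
      where
      fits′ : Fits (L + length w) (x ∷ᵉ e)
      fits′ nothing  = trans (⌊n/2^[a+b]⌋ x L (length w)) (trans (cong ⌊_/2^ length w ⌋ high) (⌊fromBits/2^length⌋≡0 w))
      fits′ (just v) = fits-+ L (length w) fits v
      runs-to : run A (start A) (L + length w) (x ∷ᵉ e) ≡ runPadding q w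
      runs-to = begin
        run A (start A) (L + length w) (x ∷ᵉ e)
          ≡⟨ cong (λ s → run A s (L + length w) (x ∷ᵉ e)) (sym (to (∈-startSet p) p∈start)) ⟩
        run A p (L + length w) (x ∷ᵉ e)
          ≡⟨ run-then-padding L (length w) p x e fits ⟩
        runPadding (run A p L (x ∷ᵉ e)) (toBits (length w) ⌊ x /2^ L ⌋)
          ≡⟨ cong₂ runPadding reaches (trans (cong (toBits (length w)) high) (toBits-fromBits w)) ⟩
        runPadding q w ∎
        where open ≡-Reasoning

compile : PA V → DFA V
compile (u ⊕ v ≐ w) = adder u v w
compile (¬ₚ φ)      = complement (compile φ)
compile (φ ∧ₚ ψ)    = product _∧_ (compile φ) (compile ψ)
compile (φ ∨ₚ ψ)    = product _∨_ (compile φ) (compile ψ)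
compile (∃ₚ φ)      = Projection.projection (compile φ)

compile-recognises : (φ : PA V) → Recognises (compile φ) φ
compile-recognises (u ⊕ v ≐ w) = adder-recognises u v w
compile-recognises (¬ₚ φ)      = complement-recognises (compile φ) φ (compile-recognises φ)
compile-recognises (φ ∧ₚ ψ)    =
  intersection-recognises (compile φ) (compile ψ) φ ψ (compile-recognises φ) (compile-recognises ψ)
compile-recognises (φ ∨ₚ ψ)    =
  union-recognises (compile φ) (compile ψ) φ ψ (compile-recognises φ) (compile-recognises ψ)
compile-recognises (∃ₚ φ)      = Projection.projection-recognises (compile φ) φ (compile-recognises φ)

decide : (φ : PA ⊥) (e : Env ⊥) → Dec (⟦ φ ⟧ₚ e)
decide φ e = Dec-map (⇔-sym (compile-recognises φ 0 e (λ ()))) (T? _)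

-- Venn regions

infix 10 #_
#_ : (Fin m → Bool) → ℕ
#_ {zero}  P = 0
#_ {suc m} P = bitValue (P zero) + # (P ∘ suc)

length-filter-tabulate : {A : Set} (P : A → Bool) (f : Fin m → A) →
                         length (filterᵇ P (List.tabulate f)) ≡ # (P ∘ f)
length-filter-tabulate {zero}  P f = refl
length-filter-tabulate {suc m} P f with P (f zero)
... | true  = cong suc (length-filter-tabulate P (f ∘ suc))
... | false = length-filter-tabulate P (f ∘ suc)

#-cong : {P Q : Fin m → Bool} → P ≗ Q → # P ≡ # Q
#-cong {zero}  P≗Q = refl
#-cong {suc m} P≗Q = cong₂ _+_ (cong bitValue (P≗Q zero)) (#-cong (P≗Q ∘ suc))

#-const-true : ∀ m → #_ {m} (const true) ≡ m
#-const-true zero    = refl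
#-const-true (suc m) = cong suc (#-const-true m)

#-const-false : (P : Fin m → Bool) → (∀ d → ¬ T (P d)) → # P ≡ 0
#-const-false {zero}  P none = refl
#-const-false {suc m} P none with P zero in P₀
... | true  = ⊥-elim (none zero (subst T (sym P₀) _))
... | false = #-const-false (P ∘ suc) (none ∘ suc)

#≢0 : (P : Fin m → Bool) → # P ≢ 0 ⇔ (∃[ d ] T (P d))
#≢0 P = mk⇔ (witness P) (nonzero P)
  where
  witness : ∀ {m} (P : Fin m → Bool) → # P ≢ 0 → ∃[ d ] T (P d)
  witness {zero}  P ≢0 = ⊥-elim (≢0 refl)
  witness {suc m} P ≢0 with P zero in P₀
  ... | true  = zero , subst T (sym P₀) _
  ... | false = let d , Pd = witness (P ∘ suc) ≢0 in suc d , Pd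
  nonzero : ∀ {m} (P : Fin m → Bool) → ∃[ d ] T (P d) → # P ≢ 0
  nonzero P (zero  , P₀) with P zero
  ... | true = λ ()
  nonzero P (suc d , Pd) with P zero
  ... | true  = λ ()
  ... | false = nonzero (P ∘ suc) (d , Pd)

#-split : (Q P : Fin m → Bool) → # (λ d → Q d ∧ P d) + # (λ d → not (Q d) ∧ P d) ≡ # P
#-split {zero}  Q P = refl
#-split {suc m} Q P = begin
  (x₀ + xs) + (y₀ + ys)           ≡⟨ interchange x₀ xs y₀ ys ⟩
  (x₀ + y₀) + (xs + ys)           ≡⟨ cong₂ _+_ (head-split (Q zero) (P zero)) (#-split (Q ∘ suc) (P ∘ suc)) ⟩
  bitValue (P zero) + # (P ∘ suc) ∎
  where
  open ≡-Reasoning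
  x₀ = bitValue (Q zero ∧ P zero)
  y₀ = bitValue (not (Q zero) ∧ P zero)
  xs = # (λ d → Q (suc d) ∧ P (suc d))
  ys = # (λ d → not (Q (suc d)) ∧ P (suc d))
  interchange : ∀ w x y z → (w + x) + (y + z) ≡ (w + y) + (x + z)
  interchange = solve-∀
  head-split : ∀ x y → bitValue (x ∧ y) + bitValue (not x ∧ y) ≡ bitValue y
  head-split true  y     = +-identityʳ _
  head-split false false = refl
  head-split false true  = refl

#-singleton : (d : Fin m) (P : Fin m → Bool) → # (λ d′ → (d′ ≟Fin d) ∧ P d′) ≡ bitValue (P d)
#-singleton {suc m} zero    P =
  trans (cong (bitValue (P zero) +_) (#-const-false (λ d → (suc d ≟Fin zero) ∧ P (suc d)) (λ _ ()))) (+-identityʳ _)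
#-singleton {suc m} (suc d) P = #-singleton d (P ∘ suc)

Colour : ℕ → Set
Colour q = Vec Bool q

_≟ᶜ_ : DecidableEquality (Colour q)
_≟ᶜ_ = ≡-decⱽ _≟ᵇ_

_==ᶜ_ : Colour q → Colour q → Bool
γ ==ᶜ δ = does (γ ≟ᶜ δ)

T-==ᶜ : (γ δ : Colour q) → T (γ ==ᶜ δ) ⇔ (γ ≡ δ)
T-==ᶜ γ δ with γ ≟ᶜ δ
... | yes γ≡δ = mk⇔ (const γ≡δ) _
... | no  γ≢δ = mk⇔ (λ ()) γ≢δ

==ᶜ-refl : (γ : Colour q) → T (γ ==ᶜ γ)
==ᶜ-refl γ = from (T-==ᶜ γ γ) refl

colour : Vec (Subset m) q → Fin m → Colour q
colour τ d = mapⱽ (λ S → lookup S d) τ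

lookup-colour : (τ : Vec (Subset m) q) (d : Fin m) (a : Fin q) → lookup (colour τ d) a ≡ lookup (lookup τ a) d
lookup-colour τ d a = lookup-map a (λ S → lookup S d) τ

colour-suc : (τ : Vec (Subset (suc m)) q) (d : Fin m) → colour τ (suc d) ≡ colour (mapⱽ tail τ) d
colour-suc []             d = refl
colour-suc ((x ∷ S) ∷ τ) d = cong (lookup S d ∷_) (colour-suc τ d)

regionSize : Vec (Subset m) q → Colour q → ℕ
regionSize τ γ = # (λ d → colour τ d ==ᶜ γ)

regionSize-suc : (τ : Vec (Subset (suc m)) q) (γ : Colour q) →
                 regionSize τ γ ≡ bitValue (colour τ zero ==ᶜ γ) + regionSize (mapⱽ tail τ) γ
regionSize-suc τ γ = cong (bitValue (colour τ zero ==ᶜ γ) +_) (#-cong λ d → cong (_==ᶜ γ) (colour-suc τ d))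

regionSize-split : (S : Subset m) (τ : Vec (Subset m) q) (γ : Colour q) →
                   regionSize (S ∷ τ) (true ∷ γ) + regionSize (S ∷ τ) (false ∷ γ) ≡ regionSize τ γ
regionSize-split S τ γ = trans
  (cong₂ _+_ (#-cong λ d → cong (_∧ (colour τ d ==ᶜ γ)) (does-≟true (lookup S d)))
             (#-cong λ d → cong (_∧ (colour τ d ==ᶜ γ)) (does-≟false (lookup S d))))
  (#-split (lookup S) (λ d → colour τ d ==ᶜ γ))

regionSize-∷-unique : (S : Subset m) (τ : Vec (Subset m) q) (c : Colour (suc q) → ℕ) →
                      (∀ γ → c (true ∷ γ) + c (false ∷ γ) ≡ regionSize τ γ) →
                      (∀ γ → c (true ∷ γ) ≡ regionSize (S ∷ τ) (true ∷ γ)) →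
                      c ≗ regionSize (S ∷ τ)
regionSize-∷-unique S τ c sums inside (true  ∷ γ) = inside γ
regionSize-∷-unique S τ c sums inside (false ∷ γ) = +-cancelˡ-≡ (c (true ∷ γ)) _ _ (begin
  c (true ∷ γ) + c (false ∷ γ)                                   ≡⟨ sums γ ⟩
  regionSize τ γ                                                 ≡⟨ regionSize-split S τ γ ⟨
  regionSize (S ∷ τ) (true ∷ γ) + regionSize (S ∷ τ) (false ∷ γ) ≡⟨ cong (_+ _) (inside γ) ⟨
  c (true ∷ γ) + regionSize (S ∷ τ) (false ∷ γ)                  ∎)
  where open ≡-Reasoning

regionSize≢0 : (τ : Vec (Subset m) q) (γ : Colour q) → regionSize τ γ ≢ 0 ⇔ (∃[ d ] colour τ d ≡ γ)
regionSize≢0 τ γ = ⇔-trans (#≢0 _) (∃-⇔ λ d → T-==ᶜ (colour τ d) γ)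

lookup-⁅⁆ : (d d′ : Fin m) → lookup ⁅ d ⁆ d′ ≡ (d′ ≟Fin d)
lookup-⁅⁆ zero    zero     = refl
lookup-⁅⁆ zero    (suc d′) = lookup⊥ d′
  where
  lookup⊥ : ∀ {m} (i : Fin m) → lookup ⊥ˢ i ≡ false
  lookup⊥ zero    = refl
  lookup⊥ (suc i) = lookup⊥ i
lookup-⁅⁆ (suc d) zero     = refl
lookup-⁅⁆ (suc d) (suc d′) = lookup-⁅⁆ d d′

regionSize-⁅⁆ : (d : Fin m) (τ : Vec (Subset m) q) (γ : Colour q) →
                regionSize (⁅ d ⁆ ∷ τ) (true ∷ γ) ≡ bitValue (colour τ d ==ᶜ γ)
regionSize-⁅⁆ d τ γ = trans
  (#-cong λ d′ → cong (_∧ (colour τ d′ ==ᶜ γ)) (trans (does-≟true _) (lookup-⁅⁆ d d′)))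
  (#-singleton d (λ d′ → colour τ d′ ==ᶜ γ))

∃-⁅⁆ : (y : Fin m) (S : Subset m) → (∃[ d ] T (lookup ⁅ y ⁆ d) × T (lookup S d)) ⇔ T (lookup S y)
∃-⁅⁆ y S = mk⇔ (λ (d , d∈y , d∈S) → subst (T ∘ lookup S) (to (T-≟Fin d y) (subst T (lookup-⁅⁆ y d) d∈y)) d∈S)
               (λ y∈S → y , subst T (sym (lookup-⁅⁆ y y)) (from (T-≟Fin y y) refl) , y∈S)

sumᶜ : (Colour q → ℕ) → ℕ
sumᶜ {zero}  f = f []
sumᶜ {suc q} f = sumᶜ (f ∘ (true ∷_)) + sumᶜ (f ∘ (false ∷_))

sumᶜ-cong : {f g : Colour q → ℕ} → f ≗ g → sumᶜ f ≡ sumᶜ g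
sumᶜ-cong {zero}  f≗g = f≗g []
sumᶜ-cong {suc q} f≗g = cong₂ _+_ (sumᶜ-cong (f≗g ∘ (true ∷_))) (sumᶜ-cong (f≗g ∘ (false ∷_)))

sumᶜ-zero : ∀ q → sumᶜ {q} (const 0) ≡ 0
sumᶜ-zero zero    = refl
sumᶜ-zero (suc q) = cong₂ _+_ (sumᶜ-zero q) (sumᶜ-zero q)

sumᶜ-+ : (f g : Colour q → ℕ) → sumᶜ (λ γ → f γ + g γ) ≡ sumᶜ f + sumᶜ g
sumᶜ-+ {zero}  f g = refl
sumᶜ-+ {suc q} f g = trans
  (cong₂ _+_ (sumᶜ-+ (f ∘ (true ∷_)) (g ∘ (true ∷_))) (sumᶜ-+ (f ∘ (false ∷_)) (g ∘ (false ∷_))))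
  (interchange (sumᶜ (f ∘ (true ∷_))) _ _ _)
  where
  interchange : ∀ w x y z → (w + x) + (y + z) ≡ (w + y) + (x + z)
  interchange = solve-∀

sumᶜ-indicator : (δ : Colour q) → sumᶜ (λ γ → bitValue (δ ==ᶜ γ)) ≡ 1
sumᶜ-indicator []          = refl
sumᶜ-indicator {suc q} (true  ∷ δ) = cong₂ _+_ (sumᶜ-indicator δ) (sumᶜ-zero q)
sumᶜ-indicator {suc q} (false ∷ δ) = cong₂ _+_ (sumᶜ-zero q) (sumᶜ-indicator δ)

#-by-colour : (c : Fin m → Colour q) (P : Fin m → Bool) →
              # P ≡ sumᶜ (λ γ → # (λ d → P d ∧ (c d ==ᶜ γ)))
#-by-colour {zero}  {q} c P = sym (sumᶜ-zero q)
#-by-colour {suc m} {q} c P = trans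
  (cong₂ _+_ first (#-by-colour (c ∘ suc) (P ∘ suc)))
  (sym (sumᶜ-+ (λ γ → bitValue (P zero ∧ (c zero ==ᶜ γ))) _))
  where
  first : bitValue (P zero) ≡ sumᶜ (λ γ → bitValue (P zero ∧ (c zero ==ᶜ γ)))
  first with P zero
  ... | true  = sym (sumᶜ-indicator (c zero))
  ... | false = sym (sumᶜ-zero q)

subsetWithCounts : (τ : Vec (Subset m) q) (a : Colour q → ℕ) → (∀ γ → a γ ≤ regionSize τ γ) →
                   ∃[ X ] ∀ γ → regionSize (X ∷ τ) (true ∷ γ) ≡ a γ
subsetWithCounts {zero}  τ a bounded = [] , λ γ → sym (n≤0⇒n≡0 (bounded γ))
subsetWithCounts {suc m} τ a bounded =
  let X , counts = subsetWithCounts (mapⱽ tail τ) a′ bounded′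
      b = not (a γ₀ ≡ᵇ 0)
  in b ∷ X , λ γ → begin
       regionSize ((b ∷ X) ∷ τ) (true ∷ γ)
         ≡⟨ regionSize-suc ((b ∷ X) ∷ τ) (true ∷ γ) ⟩
       bitValue (does (b ≟ᵇ true) ∧ (γ₀ ==ᶜ γ)) + regionSize (X ∷ mapⱽ tail τ) (true ∷ γ)
         ≡⟨ cong₂ (λ c n → bitValue (c ∧ (γ₀ ==ᶜ γ)) + n) (does-≟true b) (counts γ) ⟩
       bitValue (b ∧ (γ₀ ==ᶜ γ)) + a′ γ
         ≡⟨ first γ ⟩
       a γ ∎
  where
  γ₀ = colour τ zero
  -- element 0 goes into X exactly when its region still has to contribute a member
  a′ : Colour _ → ℕ
  a′ γ = if γ₀ ==ᶜ γ then a γ ∸ 1 else a γ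
  bounded′ : ∀ γ → a′ γ ≤ regionSize (mapⱽ tail τ) γ
  bounded′ γ with γ₀ ≟ᶜ γ | subst (a γ ≤_) (regionSize-suc τ γ) (bounded γ)
  ... | yes _ | ≤1+size = ℕ.∸-monoˡ-≤ 1 ≤1+size
  ... | no  _ | ≤size   = ≤size
  open ≡-Reasoning
  first : ∀ γ → bitValue (not (a γ₀ ≡ᵇ 0) ∧ (γ₀ ==ᶜ γ)) + a′ γ ≡ a γ
  first γ with γ₀ ≟ᶜ γ
  ... | yes refl = positive (a γ₀)
    where
    positive : ∀ n → bitValue (not (n ≡ᵇ 0) ∧ true) + (n ∸ 1) ≡ n
    positive zero    = refl
    positive (suc n) = refl
  ... | no  _    = cong (λ b → bitValue b + a γ) (∧-zeroʳ _)

modelWithCounts : (c : Colour q → ℕ) → ∃[ m ] ∃[ τ ] regionSize {m} τ ≗ c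
modelWithCounts {zero}  c = c [] , [] , λ { [] → #-const-true (c []) }
modelWithCounts {suc q} c =
  let m , τ , counts = modelWithCounts (λ γ → c (true ∷ γ) + c (false ∷ γ))
      X , countsX    = subsetWithCounts τ (c ∘ (true ∷_)) (λ γ → subst (c (true ∷ γ) ≤_) (sym (counts γ)) (m≤m+n _ _))
  in m , X ∷ τ , λ γ → sym (regionSize-∷-unique X τ c (sym ∘ counts) (sym ∘ countsX) γ)

regionSize-⁅⁆-colour : (τ : Vec (Subset m) q) {d d′ : Fin m} → colour τ d ≡ colour τ d′ →
                       regionSize (⁅ d ⁆ ∷ τ) ≗ regionSize (⁅ d′ ⁆ ∷ τ)
regionSize-⁅⁆-colour τ {d} {d′} same = regionSize-∷-unique ⁅ d′ ⁆ τ _ (regionSize-split ⁅ d ⁆ τ) λ γ →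
  trans (regionSize-⁅⁆ d τ γ) (trans (cong (λ c → bitValue (c ==ᶜ γ)) same) (sym (regionSize-⁅⁆ d′ τ γ)))

module Colourwise (τ : Vec (Subset m) q) (f : Fin m → Bool) where

  Occupied : Colour q → Set
  Occupied γ = ∃[ d ] colour τ d ≡ γ × T (f d)

  CountedAs : Colour q → ℕ → Set
  CountedAs γ x = (Occupied γ × x ≡ regionSize τ γ) ⊎ (¬ Occupied γ × x ≡ 0)

  #-colourwise : (∀ {d d′} → colour τ d ≡ colour τ d′ → T (f d) → T (f d′)) →
                 (t : Colour q → ℕ) → (∀ γ → CountedAs γ (t γ)) → # f ≡ sumᶜ t
  #-colourwise uniform t counted = trans (#-by-colour (colour τ) f) (sumᶜ-cong per-colour)
    where
    per-colour : ∀ γ → # (λ d → f d ∧ (colour τ d ==ᶜ γ)) ≡ t γ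
    per-colour γ with counted γ
    ... | inj₁ ((d₀ , d₀∈γ , fd₀) , t≡size) = trans
      (#-cong λ d → ∧-absorbs (f d) _ λ d∈γ → uniform (trans d₀∈γ (sym (to (T-==ᶜ _ γ) d∈γ))) fd₀)
      (sym t≡size)
    ... | inj₂ (unoccupied , t≡0) = trans
      (#-const-false _ λ d fd∧d∈γ → let fd , d∈γ = to T-∧ fd∧d∈γ in unoccupied (d , to (T-==ᶜ _ γ) d∈γ , fd))
      (sym t≡0)

  countedAs-exists : ∃[ t ] ∀ γ → CountedAs γ (t γ)
  countedAs-exists = (λ γ → if occupied? γ then regionSize τ γ else 0) , counted
    where
    occupied? : Colour q → Bool
    occupied? γ = any (λ d → (colour τ d ==ᶜ γ) ∧ f d) (allFin m)
    T-occupied? : ∀ γ → T (occupied? γ) ⇔ Occupied γ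
    T-occupied? γ = ⇔-trans (T-any-allFin _) (∃-⇔ λ d → ⇔-trans T-∧ (T-==ᶜ _ γ ×-⇔ ⇔-refl))
    counted : ∀ γ → CountedAs γ (if occupied? γ then regionSize τ γ else 0)
    counted γ with occupied? γ in occ
    ... | true  = inj₁ (to (T-occupied? γ) (subst T (sym occ) _) , refl)
    ... | false = inj₂ ((λ o → subst T occ (from (T-occupied? γ) o)) , refl)

-- Presburger formulas about region sizes

⊤ₚ : PA V
⊤ₚ = ∃ₚ (nothing ⊕ nothing ≐ nothing)

⊥ₚ : PA V
⊥ₚ = ¬ₚ ⊤ₚ

⟦⊥ₚ⟧ : (e : Env V) → ¬ ⟦ ⊥ₚ ⟧ₚ e
⟦⊥ₚ⟧ e ¬⊤ = ¬⊤ (0 , refl)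

_≐0 : V → PA V
u ≐0 = u ⊕ u ≐ u

⟦≐0⟧ : (u : V) (e : Env V) → ⟦ u ≐0 ⟧ₚ e ⇔ (e u ≡ 0)
⟦≐0⟧ u e = mk⇔ (λ u+u≡u → +-cancelʳ-≡ (e u) (e u) 0 u+u≡u) (λ u≡0 → subst (λ n → n + n ≡ n) (sym u≡0) refl)

_≐_ : V → V → PA V
u ≐ w = ∃ₚ (nothing ≐0 ∧ₚ just u ⊕ nothing ≐ just w)

⟦≐⟧ : (u w : V) (e : Env V) → ⟦ u ≐ w ⟧ₚ e ⇔ (e u ≡ e w)
⟦≐⟧ u w e = mk⇔
  (λ (z , z≐0 , u+z≡w) → trans (sym (+-identityʳ (e u))) (trans (cong (e u +_) (sym (to (⟦≐0⟧ nothing (z ∷ᵉ e)) z≐0))) u+z≡w))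
  (λ u≡w → 0 , refl , trans (+-identityʳ (e u)) u≡w)

_≤ₚ_ : V → V → PA V
u ≤ₚ w = ∃ₚ (just u ⊕ nothing ≐ just w)

⟦≤ₚ⟧ : (u w : V) (e : Env V) → ⟦ u ≤ₚ w ⟧ₚ e ⇔ (e u ≤ e w)
⟦≤ₚ⟧ u w e =
  mk⇔ (λ (z , u+z≡w) → subst (e u ≤_) u+z≡w (m≤m+n (e u) z)) (λ u≤w → e w ∸ e u , m+[n∸m]≡n u≤w)

_≐1 : V → PA V
-- 1 is the positive number that is not a sum of two positive ones.
u ≐1 = ¬ₚ (u ≐0) ∧ₚ
       ¬ₚ ∃ₚ ∃ₚ (¬ₚ (nothing ≐0) ∧ₚ ¬ₚ (just nothing ≐0) ∧ₚ just nothing ⊕ nothing ≐ just (just u))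

⟦≐1⟧ : (u : V) (e : Env V) → ⟦ u ≐1 ⟧ₚ e ⇔ (e u ≡ 1)
⟦≐1⟧ u e = mk⇔ (λ (≢0 , indecomposable) → one (e u) ≢0 indecomposable) (unit (e u))
  where
  Decomposable : ℕ → Set
  Decomposable n = ∃[ y ] ∃[ z ] ¬ (z + z ≡ z) × ¬ (y + y ≡ y) × y + z ≡ n
  one : ∀ n → ¬ (n + n ≡ n) → ¬ Decomposable n → n ≡ 1
  one zero          ≢0 _      = ⊥-elim (≢0 refl)
  one (suc zero)    _  _      = refl
  one (suc (suc n)) _  ¬split = ⊥-elim (¬split (1 , suc n , positive , (λ ()) , refl))
    where
    positive : ¬ (suc n + suc n ≡ suc n)
    positive double≡ with +-cancelʳ-≡ (suc n) (suc n) 0 double≡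
    ... | ()
  unit : ∀ n → n ≡ 1 → ¬ (n + n ≡ n) × ¬ Decomposable n
  unit .1 refl = (λ ()) , λ where
    (zero  , z , _   , ≢0 , _)      → ≢0 refl
    (suc y , z , z≢0 , _  , y+z≡0) → z≢0 (subst (λ k → k + k ≡ k) (sym (m+n≡0⇒n≡0 y (ℕ.suc-injective y+z≡0))) refl)

⋀ᶜ : (Colour q → PA V) → PA V
⋀ᶜ {zero}  F = F []
⋀ᶜ {suc q} F = ⋀ᶜ (F ∘ (true ∷_)) ∧ₚ ⋀ᶜ (F ∘ (false ∷_))

⟦⋀ᶜ⟧ : (F : Colour q → PA V) (e : Env V) → ⟦ ⋀ᶜ F ⟧ₚ e ⇔ (∀ γ → ⟦ F γ ⟧ₚ e)
⟦⋀ᶜ⟧ {zero}  F e = mk⇔ (λ { h [] → h }) (λ h → h [])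
⟦⋀ᶜ⟧ {suc q} F e = mk⇔
  (λ { (h₁ , h₀) (true  ∷ γ) → to (⟦⋀ᶜ⟧ (F ∘ (true ∷_)) e) h₁ γ
      ; (h₁ , h₀) (false ∷ γ) → to (⟦⋀ᶜ⟧ (F ∘ (false ∷_)) e) h₀ γ })
  (λ h → from (⟦⋀ᶜ⟧ (F ∘ (true ∷_)) e) (h ∘ (true ∷_)) , from (⟦⋀ᶜ⟧ (F ∘ (false ∷_)) e) (h ∘ (false ∷_)))

⋁ᶜ : (Colour q → PA V) → PA V
⋁ᶜ {zero}  F = F []
⋁ᶜ {suc q} F = ⋁ᶜ (F ∘ (true ∷_)) ∨ₚ ⋁ᶜ (F ∘ (false ∷_))

⟦⋁ᶜ⟧ : (F : Colour q → PA V) (e : Env V) → ⟦ ⋁ᶜ F ⟧ₚ e ⇔ (∃[ γ ] ⟦ F γ ⟧ₚ e)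
⟦⋁ᶜ⟧ {zero}  F e = mk⇔ ([] ,_) (λ { ([] , h) → h })
⟦⋁ᶜ⟧ {suc q} F e = mk⇔
  (λ { (inj₁ h) → let γ , hγ = to (⟦⋁ᶜ⟧ (F ∘ (true ∷_)) e) h in true ∷ γ , hγ
     ; (inj₂ h) → let γ , hγ = to (⟦⋁ᶜ⟧ (F ∘ (false ∷_)) e) h in false ∷ γ , hγ })
  (λ { (true ∷ γ , h) → inj₁ (from (⟦⋁ᶜ⟧ (F ∘ (true ∷_)) e) (γ , h))
     ; (false ∷ γ , h) → inj₂ (from (⟦⋁ᶜ⟧ (F ∘ (false ∷_)) e) (γ , h)) })

splitᶜ : V ⊎ Colour (suc q) → (V ⊎ Colour q) ⊎ Colour q
splitᶜ (inj₁ v)           = inj₁ (inj₁ v)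
splitᶜ (inj₂ (true ∷ γ))  = inj₁ (inj₂ γ)
splitᶜ (inj₂ (false ∷ γ)) = inj₂ γ

∃ᶜ : PA (V ⊎ Colour q) → PA V
∃ᶜ {q = zero}  φ = ∃ₚ rename [ just , const nothing ]′ φ
∃ᶜ {q = suc q} φ = ∃ᶜ (∃ᶜ (rename splitᶜ φ))

⟦∃ᶜ⟧ : (φ : PA (V ⊎ Colour q)) (e : Env V) → ⟦ ∃ᶜ φ ⟧ₚ e ⇔ (∃[ f ] ⟦ φ ⟧ₚ [ e , f ]′)
⟦∃ᶜ⟧ {q = zero} φ e = mk⇔ (λ (x , h) → const x , to (single (const x)) h) (λ (f , h) → f [] , from (single f) h)
  where
  single : ∀ f → ⟦ rename [ just , const nothing ]′ φ ⟧ₚ (f [] ∷ᵉ e) ⇔ ⟦ φ ⟧ₚ [ e , f ]′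
  single f = ⇔-trans (⟦rename⟧ₚ _ φ _) (⟦⟧ₚ-cong φ λ { (inj₁ v) → refl ; (inj₂ []) → refl })
⟦∃ᶜ⟧ {q = suc q} φ e =
  ⇔-trans (⟦∃ᶜ⟧ _ e) (⇔-trans (∃-⇔ λ f₁ → ⇔-trans (⟦∃ᶜ⟧ _ _) (∃-⇔ λ f₀ → ⟦rename⟧ₚ splitᶜ φ _))
                               (mk⇔ (λ (f₁ , f₀ , h) → join f₁ f₀ , to (⟦⟧ₚ-cong φ (joined f₁ f₀)) h)
                                    (λ (f , h) → f ∘ (true ∷_) , f ∘ (false ∷_) , from (⟦⟧ₚ-cong φ (rejoined f)) h)))
  where
  join : (Colour q → ℕ) → (Colour q → ℕ) → Colour (suc q) → ℕ
  join f₁ f₀ (true  ∷ γ) = f₁ γ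
  join f₁ f₀ (false ∷ γ) = f₀ γ
  joined : ∀ f₁ f₀ → [ [ e , f₁ ]′ , f₀ ]′ ∘ splitᶜ ≗ [ e , join f₁ f₀ ]′
  joined f₁ f₀ (inj₁ v)           = refl
  joined f₁ f₀ (inj₂ (true ∷ γ))  = refl
  joined f₁ f₀ (inj₂ (false ∷ γ)) = refl
  rejoined : ∀ f → [ [ e , f ∘ (true ∷_) ]′ , f ∘ (false ∷_) ]′ ∘ splitᶜ ≗ [ e , f ]′
  rejoined f (inj₁ v)           = refl
  rejoined f (inj₂ (true ∷ γ))  = refl
  rejoined f (inj₂ (false ∷ γ)) = refl

infix 5 Σᶜ_≐_
Σᶜ_≐_ : (Colour q → V) → V → PA V
Σᶜ_≐_ {q = zero}  t a = t [] ≐ a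
Σᶜ_≐_ {q = suc q} t a = ∃ₚ ∃ₚ (Σᶜ (lift ∘ t ∘ (true ∷_)) ≐ just nothing ∧ₚ
                               Σᶜ (lift ∘ t ∘ (false ∷_)) ≐ nothing ∧ₚ
                               just nothing ⊕ nothing ≐ lift a)
  where
  lift : _ → Maybe (Maybe _)
  lift = just ∘ just

⟦Σᶜ≐⟧ : (t : Colour q → V) (a : V) (e : Env V) → ⟦ Σᶜ t ≐ a ⟧ₚ e ⇔ (sumᶜ (e ∘ t) ≡ e a)
⟦Σᶜ≐⟧ {q = zero}  t a e = ⟦≐⟧ (t []) a e
⟦Σᶜ≐⟧ {q = suc q} t a e = mk⇔
  (λ (y , x , sum₁ , sum₀ , y+x≡a) →
     trans (cong₂ _+_ (to (⟦Σᶜ≐⟧ _ _ (x ∷ᵉ y ∷ᵉ e)) sum₁) (to (⟦Σᶜ≐⟧ _ _ (x ∷ᵉ y ∷ᵉ e)) sum₀)) y+x≡a)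
  (λ sum≡a → sumᶜ (e ∘ t ∘ (true ∷_)) , sumᶜ (e ∘ t ∘ (false ∷_)) ,
             from (⟦Σᶜ≐⟧ _ _ _) refl , from (⟦Σᶜ≐⟧ _ _ _) refl , sum≡a)

_≐bit_ : V → Bool → PA V
u ≐bit false = u ≐0
u ≐bit true  = u ≐1

⟦≐bit⟧ : (u : V) (b : Bool) (e : Env V) → ⟦ u ≐bit b ⟧ₚ e ⇔ (e u ≡ bitValue b)
⟦≐bit⟧ u false = ⟦≐0⟧ u
⟦≐bit⟧ u true  = ⟦≐1⟧ u

guard : Bool → PA V → PA V
guard b φ = if b then φ else ⊥ₚ

⟦guard⟧ : (b : Bool) (φ : PA V) (e : Env V) → ⟦ guard b φ ⟧ₚ e ⇔ (T b × ⟦ φ ⟧ₚ e)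
⟦guard⟧ true  φ e = mk⇔ (_ ,_) proj₂
⟦guard⟧ false φ e = mk⇔ (⊥-elim ∘ ⟦⊥ₚ⟧ e) (λ ())

splits : PA (Colour q ⊎ Colour (suc q))
splits = ⋀ᶜ λ γ → inj₂ (true ∷ γ) ⊕ inj₂ (false ∷ γ) ≐ inj₁ γ

⟦splits⟧ : (e : Colour q → ℕ) (c : Colour (suc q) → ℕ) →
           ⟦ splits ⟧ₚ [ e , c ]′ ⇔ (∀ γ → c (true ∷ γ) + c (false ∷ γ) ≡ e γ)
⟦splits⟧ e c = ⟦⋀ᶜ⟧ _ _

-- A new set X splits every region γ into γ ∩ X and γ ∖ X, and by subsetWithCounts every
-- splitting of the region sizes arises from some X.
∃ˢ : PA (Colour (suc q)) → PA (Colour q)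
∃ˢ Ψ = ∃ᶜ (splits ∧ₚ rename inj₂ Ψ)

⟦∃ˢ⟧ : (τ : Vec (Subset m) q) (Ψ : PA (Colour (suc q))) →
       ⟦ ∃ˢ Ψ ⟧ₚ (regionSize τ) ⇔ (∃[ X ] ⟦ Ψ ⟧ₚ (regionSize (X ∷ τ)))
⟦∃ˢ⟧ τ Ψ = ⇔-trans (⟦∃ᶜ⟧ _ _) (mk⇔ realise split)
  where
  realise : ∃[ c ] ⟦ splits ∧ₚ rename inj₂ Ψ ⟧ₚ [ regionSize τ , c ]′ → ∃[ X ] ⟦ Ψ ⟧ₚ (regionSize (X ∷ τ))
  realise (c , c-splits , Ψc) =
    let sums   = to (⟦splits⟧ _ c) c-splits
        X , cX = subsetWithCounts τ (c ∘ (true ∷_)) (λ γ → subst (c (true ∷ γ) ≤_) (sums γ) (m≤m+n _ _))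
    in X , to (⟦⟧ₚ-cong Ψ (regionSize-∷-unique X τ c sums (sym ∘ cX))) (to (⟦rename⟧ₚ inj₂ Ψ _) Ψc)
  split : ∃[ X ] ⟦ Ψ ⟧ₚ (regionSize (X ∷ τ)) → ∃[ c ] ⟦ splits ∧ₚ rename inj₂ Ψ ⟧ₚ [ regionSize τ , c ]′
  split (X , ΨX) = regionSize (X ∷ τ) , from (⟦splits⟧ _ _) (regionSize-split X τ) , from (⟦rename⟧ₚ inj₂ Ψ _) ΨX

-- The singleton {d} splits the region of d as 1 + (size − 1) and every other one as 0 + size.
∃ᵉ : Colour q → PA (Colour (suc q)) → PA (Colour q)
∃ᵉ γ Ψ = ∃ᶜ (splits ∧ₚ (⋀ᶜ λ γ′ → inj₂ (true ∷ γ′) ≐bit (γ ==ᶜ γ′)) ∧ₚ rename inj₂ Ψ)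

⟦∃ᵉ⟧ : (τ : Vec (Subset m) q) (γ : Colour q) (Ψ : PA (Colour (suc q))) →
       ⟦ ∃ᵉ γ Ψ ⟧ₚ (regionSize τ) ⇔ (∃[ d ] colour τ d ≡ γ × ⟦ Ψ ⟧ₚ (regionSize (⁅ d ⁆ ∷ τ)))
⟦∃ᵉ⟧ τ γ Ψ = ⇔-trans (⟦∃ᶜ⟧ _ _) (mk⇔ element singleton)
  where
  element : _ → ∃[ d ] colour τ d ≡ γ × ⟦ Ψ ⟧ₚ (regionSize (⁅ d ⁆ ∷ τ))
  element (c , c-splits , c-indicator , Ψc) =
    let sums      = to (⟦splits⟧ _ c) c-splits
        indicator = λ γ′ → to (⟦≐bit⟧ _ _ _) (to (⟦⋀ᶜ⟧ _ _) c-indicator γ′)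
        γ-once    = trans (indicator γ) (cong bitValue (to T-≡ (==ᶜ-refl γ)))
        d , d∈γ   = to (regionSize≢0 τ γ) λ size≡0 →
                      1+n≢0 (trans (cong (_+ c (false ∷ γ)) (sym γ-once)) (trans (sums γ) size≡0))
    in d , d∈γ , to (⟦⟧ₚ-cong Ψ (regionSize-∷-unique ⁅ d ⁆ τ c sums λ γ′ →
                      trans (indicator γ′) (sym (trans (regionSize-⁅⁆ d τ γ′) (cong (λ δ → bitValue (δ ==ᶜ γ′)) d∈γ)))))
                    (to (⟦rename⟧ₚ inj₂ Ψ _) Ψc)
  singleton : ∃[ d ] colour τ d ≡ γ × ⟦ Ψ ⟧ₚ (regionSize (⁅ d ⁆ ∷ τ)) → _
  singleton (d , refl , Ψd) =
    regionSize (⁅ d ⁆ ∷ τ) , from (⟦splits⟧ _ _) (regionSize-split ⁅ d ⁆ τ) ,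
    from (⟦⋀ᶜ⟧ _ _) (λ γ′ → from (⟦≐bit⟧ _ _ _) (regionSize-⁅⁆ d τ γ′)) , from (⟦rename⟧ₚ inj₂ Ψ _) Ψd

∃¹ : PA (Colour (suc q)) → PA (Colour q)
∃¹ Ψ = ⋁ᶜ λ γ → ∃ᵉ γ Ψ

⟦∃¹⟧ : (τ : Vec (Subset m) q) (Ψ : PA (Colour (suc q))) →
       ⟦ ∃¹ Ψ ⟧ₚ (regionSize τ) ⇔ (∃[ d ] ⟦ Ψ ⟧ₚ (regionSize (⁅ d ⁆ ∷ τ)))
⟦∃¹⟧ τ Ψ = ⇔-trans (⟦⋁ᶜ⟧ _ _) (⇔-trans (∃-⇔ λ γ → ⟦∃ᵉ⟧ τ γ Ψ)
  (mk⇔ (λ (_ , d , _ , Ψd) → d , Ψd) (λ (d , Ψd) → colour τ d , d , refl , Ψd)))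

meet : Fin q → Fin q → PA (Colour q)
meet a b = ⋁ᶜ λ γ → guard (lookup γ a ∧ lookup γ b) (¬ₚ (γ ≐0))

⟦meet⟧ : (τ : Vec (Subset m) q) (a b : Fin q) →
         ⟦ meet a b ⟧ₚ (regionSize τ) ⇔ (∃[ d ] T (lookup (lookup τ a) d) × T (lookup (lookup τ b) d))
⟦meet⟧ τ a b = ⇔-trans (⟦⋁ᶜ⟧ _ _)
  (⇔-trans (∃-⇔ λ γ → ⇔-trans (⟦guard⟧ _ _ _)
                        (⇔-refl ×-⇔ ⇔-trans (¬-cong-⇔ (⟦≐0⟧ γ (regionSize τ))) (regionSize≢0 τ γ)))
           (mk⇔ (λ { (γ , in-a∧b , d , refl) → d , to in-both in-a∧b })
                (λ (d , in-a , in-b) → colour τ d , from in-both (in-a , in-b) , d , refl)))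
  where
  in-colour : ∀ {d} i → T (lookup (colour τ d) i) ⇔ T (lookup (lookup τ i) d)
  in-colour {d} i = T-≡-⇔ (lookup-colour τ d i)
  in-both : ∀ {d} → T (lookup (colour τ d) a ∧ lookup (colour τ d) b) ⇔
                    (T (lookup (lookup τ a) d) × T (lookup (lookup τ b) d))
  in-both = ⇔-trans T-∧ (in-colour a ×-⇔ in-colour b)

-- Φ holds at d iff it holds at every element of d's colour (regionSize-⁅⁆-colour), so #Φ is
-- the sum of the sizes of the regions in which Φ holds somewhere; countΦ γ is that summand.
module Counting {q : ℕ} where

  Vars : Set
  Vars = Maybe (Maybe ((Colour q ⊎ Colour q) ⊎ Colour q))

  region countΦ countΨ : Colour q → Vars
  region γ = just (just (inj₁ (inj₁ γ)))
  countΦ γ = just (just (inj₁ (inj₂ γ)))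
  countΨ γ = just (just (inj₂ γ))

  chosen : PA (Colour q) → Colour q → Vars → PA Vars
  chosen F γ w = (rename region F ∧ₚ w ≐ region γ) ∨ₚ (¬ₚ rename region F ∧ₚ w ≐0)

  ⟦chosen⟧ : (F : PA (Colour q)) (γ : Colour q) (w : Vars) (e : Env Vars) →
             ⟦ chosen F γ w ⟧ₚ e ⇔
             ((⟦ F ⟧ₚ (e ∘ region) × e w ≡ e (region γ)) ⊎ (¬ ⟦ F ⟧ₚ (e ∘ region) × e w ≡ 0))
  ⟦chosen⟧ F γ w e =
    (⟦rename⟧ₚ region F e ×-⇔ ⟦≐⟧ w (region γ) e) ⊎-⇔ (¬-cong-⇔ (⟦rename⟧ₚ region F e) ×-⇔ ⟦≐0⟧ w e)

  comparison : PA (Colour (suc q)) → PA (Colour (suc q)) → PA Vars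
  comparison Φ Ψ = (⋀ᶜ λ γ → chosen (∃ᵉ γ Φ) γ (countΦ γ)) ∧ₚ (⋀ᶜ λ γ → chosen (∃ᵉ γ Ψ) γ (countΨ γ)) ∧ₚ
                   Σᶜ countΦ ≐ just nothing ∧ₚ Σᶜ countΨ ≐ nothing ∧ₚ nothing ≤ₚ just nothing

  atLeast : PA (Colour (suc q)) → PA (Colour (suc q)) → PA (Colour q)
  atLeast Φ Ψ = ∃ᶜ (∃ᶜ (∃ₚ ∃ₚ comparison Φ Ψ))

  module _ {m} (τ : Vec (Subset m) q) where

    private
      env : (Colour q → ℕ) → (Colour q → ℕ) → ℕ → ℕ → Env Vars
      env tᵥ uᵥ a b = b ∷ᵉ a ∷ᵉ [ [ regionSize τ , tᵥ ]′ , uᵥ ]′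

      module _ (Θ : PA (Colour (suc q))) (h : Fin m → Bool)
               (Θ⇔h : ∀ d → ⟦ Θ ⟧ₚ (regionSize (⁅ d ⁆ ∷ τ)) ⇔ T (h d)) where
        open Colourwise τ h

        uniform : ∀ {d d′} → colour τ d ≡ colour τ d′ → T (h d) → T (h d′)
        uniform same = to (Θ⇔h _) ∘ to (⟦⟧ₚ-cong Θ (regionSize-⁅⁆-colour τ same)) ∘ from (Θ⇔h _)

        ∃ᵉ⇔Occupied : ∀ γ → ⟦ ∃ᵉ γ Θ ⟧ₚ (regionSize τ) ⇔ Occupied γ
        ∃ᵉ⇔Occupied γ = ⇔-trans (⟦∃ᵉ⟧ τ γ Θ) (∃-⇔ λ d → ⇔-refl ×-⇔ Θ⇔h d)

        allChosen⇔CountedAs : (w : Colour q → Vars) (tᵥ uᵥ : Colour q → ℕ) (a b : ℕ) →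
                              ⟦ ⋀ᶜ (λ γ → chosen (∃ᵉ γ Θ) γ (w γ)) ⟧ₚ (env tᵥ uᵥ a b) ⇔
                              (∀ γ → CountedAs γ (env tᵥ uᵥ a b (w γ)))
        allChosen⇔CountedAs w tᵥ uᵥ a b = ⇔-trans (⟦⋀ᶜ⟧ _ _) (∀-⇔ λ γ →
          ⇔-trans (⟦chosen⟧ (∃ᵉ γ Θ) γ (w γ) (env tᵥ uᵥ a b))
                  ((∃ᵉ⇔Occupied γ ×-⇔ ⇔-refl) ⊎-⇔ (¬-cong-⇔ (∃ᵉ⇔Occupied γ) ×-⇔ ⇔-refl)))

        #-sum : (t : Colour q → ℕ) → (∀ γ → CountedAs γ (t γ)) → # h ≡ sumᶜ t
        #-sum = #-colourwise uniform

    ⟦atLeast⟧ : (Φ Ψ : PA (Colour (suc q))) (f g : Fin m → Bool) →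
                (∀ d → ⟦ Φ ⟧ₚ (regionSize (⁅ d ⁆ ∷ τ)) ⇔ T (f d)) →
                (∀ d → ⟦ Ψ ⟧ₚ (regionSize (⁅ d ⁆ ∷ τ)) ⇔ T (g d)) →
                ⟦ atLeast Φ Ψ ⟧ₚ (regionSize τ) ⇔ (# g ≤ # f)
    ⟦atLeast⟧ Φ Ψ f g Φ⇔f Ψ⇔g = ⇔-trans (⟦∃ᶜ⟧ _ _) (mk⇔ compare witness)
      where
      compare : ∃[ tᵥ ] ⟦ ∃ᶜ (∃ₚ ∃ₚ comparison Φ Ψ) ⟧ₚ [ regionSize τ , tᵥ ]′ → # g ≤ # f
      compare (tᵥ , h)
        with uᵥ , a , b , chosenΦ , chosenΨ , Σt≡a , Σu≡b , b≤a ← to (⟦∃ᶜ⟧ (∃ₚ ∃ₚ comparison Φ Ψ) _) h = begin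
        # g     ≡⟨ #-sum Ψ g Ψ⇔g uᵥ (to (allChosen⇔CountedAs Ψ g Ψ⇔g countΨ tᵥ uᵥ a b) chosenΨ) ⟩
        sumᶜ uᵥ ≡⟨ to (⟦Σᶜ≐⟧ countΨ nothing (env tᵥ uᵥ a b)) Σu≡b ⟩
        b       ≤⟨ to (⟦≤ₚ⟧ nothing (just nothing) (env tᵥ uᵥ a b)) b≤a ⟩
        a       ≡⟨ to (⟦Σᶜ≐⟧ countΦ (just nothing) (env tᵥ uᵥ a b)) Σt≡a ⟨
        sumᶜ tᵥ ≡⟨ #-sum Φ f Φ⇔f tᵥ (to (allChosen⇔CountedAs Φ f Φ⇔f countΦ tᵥ uᵥ a b) chosenΦ) ⟨
        # f     ∎
        where open ℕ.≤-Reasoning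
      witness : # g ≤ # f → ∃[ tᵥ ] ⟦ ∃ᶜ (∃ₚ ∃ₚ comparison Φ Ψ) ⟧ₚ [ regionSize τ , tᵥ ]′
      witness g≤f =
        let tᵥ , countedΦ = Colourwise.countedAs-exists τ f
            uᵥ , countedΨ = Colourwise.countedAs-exists τ g
            a = sumᶜ tᵥ
            b = sumᶜ uᵥ
        in tᵥ , from (⟦∃ᶜ⟧ (∃ₚ ∃ₚ comparison Φ Ψ) _) (uᵥ , a , b ,
             from (allChosen⇔CountedAs Φ f Φ⇔f countΦ tᵥ uᵥ a b) countedΦ ,
             from (allChosen⇔CountedAs Ψ g Ψ⇔g countΨ tᵥ uᵥ a b) countedΨ ,
             from (⟦Σᶜ≐⟧ countΦ (just nothing) (env tᵥ uᵥ a b)) refl ,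
             from (⟦Σᶜ≐⟧ countΨ nothing (env tᵥ uᵥ a b)) refl ,
             from (⟦≤ₚ⟧ nothing (just nothing) (env tᵥ uᵥ a b))
                  (subst₂ _≤_ (#-sum Ψ g Ψ⇔g uᵥ countedΨ) (#-sum Φ f Φ⇔f tᵥ countedΦ) g≤f))

open Counting using (atLeast; ⟦atLeast⟧)

-- Translation

meet-⁅⁆ : (τ : Vec (Subset m) q) (a b : Fin q) {y : Fin m} {S : Subset m} →
          lookup τ a ≡ ⁅ y ⁆ → lookup τ b ≡ S → ⟦ meet a b ⟧ₚ (regionSize τ) ⇔ T (lookup S y)
meet-⁅⁆ τ a b {y} {S} a≡y b≡S = ⇔-trans (⟦meet⟧ τ a b)
  (⇔-trans (∃-⇔ λ d → T-≡-⇔ (cong (λ A → lookup A d) a≡y) ×-⇔ T-≡-⇔ (cong (λ B → lookup B d) b≡S))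
           (∃-⁅⁆ y S))

¬ₚ-not : (φ : PA V) (e : Env V) (b : Bool) → ⟦ φ ⟧ₚ e ⇔ T b → ⟦ ¬ₚ φ ⟧ₚ e ⇔ T (not b)
¬ₚ-not φ e b φ⇔b = ⇔-trans (¬-cong-⇔ φ⇔b) (⇔-sym (T-not b))

∃¹-any : (τ : Vec (Subset m) q) (Ψ : PA (Colour (suc q))) (h : Fin m → Bool) →
         (∀ d → ⟦ Ψ ⟧ₚ (regionSize (⁅ d ⁆ ∷ τ)) ⇔ T (h d)) →
         ⟦ ∃¹ Ψ ⟧ₚ (regionSize τ) ⇔ T (any h (allFin m))
∃¹-any τ Ψ h Ψ⇔h = ⇔-trans (⟦∃¹⟧ τ Ψ) (⇔-trans (∃-⇔ Ψ⇔h) (⇔-sym (T-any-allFin h)))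

∃ˢ-any : (τ : Vec (Subset m) q) (Ψ : PA (Colour (suc q))) (h : Subset m → Bool) →
         (∀ X → ⟦ Ψ ⟧ₚ (regionSize (X ∷ τ)) ⇔ T (h X)) →
         ⟦ ∃ˢ Ψ ⟧ₚ (regionSize τ) ⇔ T (any h (allSubsets m))
∃ˢ-any {m} τ Ψ h Ψ⇔h = ⇔-trans (⟦∃ˢ⟧ τ Ψ) (⇔-trans (∃-⇔ Ψ⇔h) (⇔-trans
  (mk⇔ (λ (X , hX) → X , ∈-allSubsets m X , hX) (λ (X , _ , hX) → X , hX)) (⇔-sym (T-any h (allSubsets m)))))

#≤#⇔length-filter≤ᵇ : (f g : Fin m → Bool) →
                      (# g ≤ # f) ⇔ T (length (filterᵇ g (allFin m)) ≤ᵇ length (filterᵇ f (allFin m)))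
#≤#⇔length-filter≤ᵇ f g rewrite length-filter-tabulate g id | length-filter-tabulate f id =
  mk⇔ ≤⇒≤ᵇ (≤ᵇ⇒≤ _ _)

-- Each free variable and predicate symbol occupies one of the q sets of a coloured model;
-- an individual d is stored as the singleton {d}.
record Slots (p i j q : ℕ) : Set where
  field
    individual : Fin i → Fin q
    setVar     : Fin j → Fin q
    predicate  : Fin p → Fin q

open Slots

pushIndividual : Slots p i j q → Slots p (suc i) j (suc q)
pushIndividual s = record
  { individual = λ { zero → zero ; (suc x) → suc (individual s x) }
  ; setVar     = suc ∘ setVar s
  ; predicate  = suc ∘ predicate s
  }

pushSet : Slots p i j q → Slots p i (suc j) (suc q)
pushSet s = record
  { individual = suc ∘ individual s
  ; setVar     = λ { zero → zero ; (suc X) → suc (setVar s X) }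
  ; predicate  = suc ∘ predicate s
  }

translate : Formula p i j → Slots p i j q → PA (Colour q)
translate (pred k x)  s = meet (individual s x) (predicate s k)
translate (mem X x)   s = meet (individual s x) (setVar s X)
translate (eq x y)    s = meet (individual s x) (individual s y)
translate ⊤f          s = ⊤ₚ
translate (¬f φ)      s = ¬ₚ translate φ s
translate (φ ∧f ψ)    s = translate φ s ∧ₚ translate ψ s
translate (φ ∨f ψ)    s = translate φ s ∨ₚ translate ψ s
translate (∃₁ φ)      s = ∃¹ (translate φ (pushIndividual s))
translate (∀₁ φ)      s = ¬ₚ ∃¹ (¬ₚ translate φ (pushIndividual s))
translate (∃₂ φ)      s = ∃ˢ (translate φ (pushSet s))
translate (∀₂ φ)      s = ¬ₚ ∃ˢ (¬ₚ translate φ (pushSet s))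
translate (count φ ψ) s = atLeast (translate φ (pushIndividual s)) (translate ψ (pushIndividual s))

record Represents (I : Fin p → Subset m) (ρ : Vec (Fin m) i) (σ : Vec (Subset m) j)
                  (τ : Vec (Subset m) q) (s : Slots p i j q) : Set where
  field
    individual-⁅⁆ : ∀ x → lookup τ (individual s x) ≡ ⁅ lookup ρ x ⁆
    setVar-set    : ∀ X → lookup τ (setVar s X) ≡ lookup σ X
    predicate-set : ∀ k → lookup τ (predicate s k) ≡ I k

open Represents

represents-pushIndividual : ∀ {I : Fin p → Subset m} {ρ : Vec (Fin m) i} {σ : Vec (Subset m) j} {τ : Vec (Subset m) q} {s} →
                            Represents I ρ σ τ s → ∀ d → Represents I (d ∷ ρ) σ (⁅ d ⁆ ∷ τ) (pushIndividual s)
represents-pushIndividual r d = record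
  { individual-⁅⁆ = λ { zero → refl ; (suc x) → individual-⁅⁆ r x }
  ; setVar-set    = setVar-set r
  ; predicate-set = predicate-set r
  }

represents-pushSet : ∀ {I : Fin p → Subset m} {ρ : Vec (Fin m) i} {σ : Vec (Subset m) j} {τ : Vec (Subset m) q} {s} →
                     Represents I ρ σ τ s → ∀ X → Represents I ρ (X ∷ σ) (X ∷ τ) (pushSet s)
represents-pushSet r X = record
  { individual-⁅⁆ = individual-⁅⁆ r
  ; setVar-set    = λ { zero → refl ; (suc Y) → setVar-set r Y }
  ; predicate-set = predicate-set r
  }

translate-correct : (φ : Formula p i j) {I : Fin p → Subset m} {ρ : Vec (Fin m) i} {σ : Vec (Subset m) j}
                    {τ : Vec (Subset m) q} {s : Slots p i j q} → Represents I ρ σ τ s →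
                    ⟦ translate φ s ⟧ₚ (regionSize τ) ⇔ T (⟦ φ ⟧ I ρ σ)
translate-correct (pred k x) {τ = τ} r = meet-⁅⁆ τ _ _ (individual-⁅⁆ r x) (predicate-set r k)
translate-correct (mem X x)  {τ = τ} r = meet-⁅⁆ τ _ _ (individual-⁅⁆ r x) (setVar-set r X)
translate-correct (eq x y) {ρ = ρ} {τ = τ} r =
  ⇔-trans (meet-⁅⁆ τ _ _ (individual-⁅⁆ r x) (individual-⁅⁆ r y)) (T-≡-⇔ (lookup-⁅⁆ (lookup ρ y) (lookup ρ x)))
translate-correct ⊤f         r = mk⇔ _ (λ _ → 0 , refl)
translate-correct (¬f φ)     r = ¬ₚ-not (translate φ _) _ _ (translate-correct φ r)
translate-correct (φ ∧f ψ)   r = ⇔-trans (translate-correct φ r ×-⇔ translate-correct ψ r) (⇔-sym T-∧)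
translate-correct (φ ∨f ψ)   r = ⇔-trans (translate-correct φ r ⊎-⇔ translate-correct ψ r) (⇔-sym T-∨)
translate-correct (∃₁ φ) {τ = τ} r =
  ∃¹-any τ _ _ λ d → translate-correct φ (represents-pushIndividual r d)
translate-correct (∀₁ φ) {τ = τ} r = ¬ₚ-not _ _ _
  (∃¹-any τ _ _ λ d → ¬ₚ-not _ _ _ (translate-correct φ (represents-pushIndividual r d)))
translate-correct (∃₂ φ) {τ = τ} r =
  ∃ˢ-any τ _ _ λ X → translate-correct φ (represents-pushSet r X)
translate-correct (∀₂ φ) {τ = τ} r = ¬ₚ-not _ _ _
  (∃ˢ-any τ _ _ λ X → ¬ₚ-not _ _ _ (translate-correct φ (represents-pushSet r X)))
translate-correct (count φ ψ) {I = I} {ρ} {σ} {τ} r =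
  ⇔-trans (⟦atLeast⟧ τ _ _ _ _ (λ d → translate-correct φ (represents-pushIndividual r d))
                               (λ d → translate-correct ψ (represents-pushIndividual r d)))
          (#≤#⇔length-filter≤ᵇ (λ d → ⟦ φ ⟧ I (d ∷ ρ) σ) (λ d → ⟦ ψ ⟧ I (d ∷ ρ) σ))

predicatesOnly : Slots p 0 0 p
predicatesOnly = record { individual = λ () ; setVar = λ () ; predicate = id }

represents-predicates : {I : Fin p → Subset m} (τ : Vec (Subset m) p) → (∀ k → lookup τ k ≡ I k) →
                        Represents I [] [] τ predicatesOnly
represents-predicates τ τ≡I = record { individual-⁅⁆ = λ () ; setVar-set = λ () ; predicate-set = τ≡I }

-- Valid iff no region-size vector with a nonempty region falsifies the translation; every such
-- vector comes from a model (modelWithCounts).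
refutation : Sentence p → PA (⊥ ⊎ Colour p)
refutation φ = (⋁ᶜ λ γ → ¬ₚ (inj₂ γ ≐0)) ∧ₚ ¬ₚ rename inj₂ (translate φ predicatesOnly)

closure : Sentence p → PA ⊥
closure φ = ¬ₚ ∃ᶜ (refutation φ)

valid⇔closure : (φ : Sentence p) → Valid φ ⇔ ⟦ closure φ ⟧ₚ ⊥-elim
valid⇔closure {p} φ = mk⇔ noCounterexample everyModel
  where
  Counterexample : (Colour p → ℕ) → Set
  Counterexample c = (∃[ γ ] c γ ≢ 0) × ¬ ⟦ translate φ predicatesOnly ⟧ₚ c

  counterexample⇔ : ∀ c → ⟦ refutation φ ⟧ₚ [ ⊥-elim , c ]′ ⇔ Counterexample c
  counterexample⇔ c =
    ⇔-trans (⟦⋁ᶜ⟧ _ _) (∃-⇔ λ γ → ¬-cong-⇔ (⟦≐0⟧ (inj₂ γ) [ ⊥-elim , c ]′)) ×-⇔ ¬-cong-⇔ (⟦rename⟧ₚ inj₂ _ _)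

  noCounterexample : Valid φ → ⟦ closure φ ⟧ₚ ⊥-elim
  noCounterexample valid h with c , ce ← to (⟦∃ᶜ⟧ _ _) h
                           with m , τ , sizes ← modelWithCounts c
                           = refute m τ sizes (to (counterexample⇔ c) ce)
    where
    refute : ∀ m (τ : Vec (Subset m) p) → regionSize τ ≗ c → ¬ Counterexample c
    refute zero    τ sizes ((γ , cγ≢0) , _) = cγ≢0 (sym (sizes γ))
    refute (suc n) τ sizes (_ , ¬φ) = ¬φ (to (⟦⟧ₚ-cong _ sizes)
      (from (translate-correct φ (represents-predicates τ λ _ → refl)) (from T-≡ (valid n (lookup τ)))))

  everyModel : ⟦ closure φ ⟧ₚ ⊥-elim → Valid φ
  everyModel h n I = to T-≡ (decidable-stable (T? _) λ ¬φ →
    h (from (⟦∃ᶜ⟧ _ _) (regionSize τ , from (counterexample⇔ (regionSize τ))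
         ((colour τ zero , from (regionSize≢0 τ _) (zero , refl)) ,
          ¬φ ∘ to (translate-correct φ (represents-predicates τ (lookup∘tabulate I)))))))
    where
    τ = tabulate I

corollary4p11 : (p : ℕ) → (φ : Sentence p) → Dec (Valid φ)
corollary4p11 p φ = Dec-map (⇔-sym (valid⇔closure φ)) (decide (closure φ) ⊥-elim)
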